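{- Let $n\ge 2$ and for each $k\in[n]$ let $\lambda^{(k)}$ be a partition with $k$ (possibly zero) parts. Then the Minkowski sum $\mathrm{GT}(\lambda^{(1)})+\cdots+\mathrm{GT}(\lambda^{(n)})\subset\mathbb{R}^{\binom{n+1}{2}}$ is integrally equivalent to the Minkowski sum $\mathcal{F}_{G_{\lambda^{(1)}}}+\cdots+\mathcal{F}_{G_{\lambda^{(n)}}}\subset\mathbb{R}^{E(G_{\lambda^{(n)}})}$, with the embeddings described in the context.
   Context: For a partition $\lambda$ with $k$ parts, $\mathrm{GT}(\lambda)\subset\mathbb{R}^{\binom{k+1}{2}}$ is the set of nonnegative arrays $(y_{ij})_{1\le i\le j\le k}$ with $y_{1j}=\lambda_j$ and $y_{i-1,j-1}\ge y_{ij}\ge y_{i-1,j}$ for $2\le i\le j\le k$; it is embedded into $\mathbb{R}^{\binom{n+1}{2}}$ (coordinates $x_{ij}$, $1\le i\le j\le n$) by $y_{ij}\mapsto x_{i,j+n-k}$, other coordinates $0$. For $k\ge2$, the flow network $G_\lambda$ has vertices $v_{ij}$ ($2\le i\le j\le k$), $v_{i,i-1}$ ($3\le i\le k+2$), $v_{i,k+1}$ ($3\le i\le k+1$), edges $(v_{ij},v_{i+1,j})$ ($2\le i\le j\le k$), $(v_{i,k+1},v_{i+1,k+1})$ ($3\le i\le k+1$), $(v_{ij},v_{i+1,j+1})$ ($2\le i\le j\le k$), $(v_{i,i-1},v_{i+1,i})$ ($3\le i\le k+1$), and netflow $\lambda_{j-1}-\lambda_j$ at $v_{2j}$ ($2\le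 j\le k$), $\lambda_k-\lambda_1$ at $v_{k+2,k+1}$, $0$ elsewhere; $\mathcal{F}_{G_\lambda}\subset\mathbb{R}^{E(G_\lambda)}_{\ge0}$ is the set of nonnegative edge flows with inflow plus netflow equal to outflow at each vertex. For $k=1$, $G_\lambda$ is a single vertex and $\mathcal{F}_{G_\lambda}$ is the single point $0$. The graph $G_{\lambda^{(k)}}$ is embedded into $G_{\lambda^{(n)}}$ by identifying the vertex $v_{ij}$ of $G_{\lambda^{(k)}}$ with the vertex $v_{i,j+n-k}$ of $G_{\lambda^{(n)}}$ (edges going to the corresponding edges), which embeds $\mathbb{R}^{E(G_{\lambda^{(k)}})}$ into $\mathbb{R}^{E(G_{\lambda^{(n)}})}$ with other coordinates $0$. Integral equivalence: polytopes $\mathcal{P}\subset\mathbb{R}^d$, $\mathcal{Q}\subset\mathbb{R}^m$ are integrally equivalent if an affine map $\mathbb{R}^d\to\mathbb{R}^m$ restricts to a bijection $\mathcal{P}\to\mathcal{Q}$ and a bijection $\mathbb{Z}^d\cap\mathrm{aff}(\mathcal{P})\to\mathbb{Z}^m\cap\mathrm{aff}(\mathcal{Q})$.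
   Formalization: The Minkowski sums, affine hulls and the affine map of integral equivalence are taken over ℚ in place of ℝ: points have rational coordinates and the map has rational coefficients. -}

module Defs where

open import Data.Bool using (Bool; true; false; if_then_else_; _∧_; _∨_; T)
open import Data.Nat using (ℕ; zero; suc; _∸_; _≤_)
  renaming (_+_ to _+ℕ_)
import Data.Nat as N

open import Data.Integer using (+_)
open import Data.List using (List; []; _∷_; map; upTo; concatMap; filterᵇ; foldr)
open import Data.List.Membership.Propositional using (_∈_)
open import Data.Product using (Σ; ∃; _×_; _,_)
open import Data.Rational using (ℚ; 0ℚ; 1ℚ; _+_; _*_; _-_; _/_)
  renaming (_≤_ to _≤ℚ_)
open import Relation.Binary.PropositionalEquality using (_≡_)

infix 7 _≤ᵇ_ _≡ᵇ_
_≤ᵇ_ : ℕ → ℕ → Bool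
_≤ᵇ_ = N._≤ᵇ_
_≡ᵇ_ : ℕ → ℕ → Bool
_≡ᵇ_ = N._≡ᵇ_

ℕ→ℚ : ℕ → ℚ
ℕ→ℚ m = + m / 1

sumℚ : List ℚ → ℚ
sumℚ = foldr _+_ 0ℚ

between : ℕ → ℕ → List ℕ
between a b = map (a +ℕ_) (upTo (suc b ∸ a))

-- A coordinate space ℚ^I with a finite enumerated index set I.
record Space : Set₁ where
  field
    Ix     : Set
    coords : List Ix

open Space public

Pt : Space → Set
Pt S = Ix S → ℚ

_≈[_]_ : {S : Space} → Pt S → (Sp : Space) → Pt S → Set
_≈[_]_ {S} x _ y = ∀ e → e ∈ coords S → x e ≡ y e

IsInt : ℚ → Set
IsInt q = ℚ.denominator-1 q ≡ 0

IsIntPt : (S : Space) → Pt S → Set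
IsIntPt S x = ∀ e → e ∈ coords S → IsInt (x e)

record Affine (S T : Space) : Set where
  field
    A : Ix T → Ix S → ℚ
    b : Ix T → ℚ

apply : {S T : Space} → Affine S T → Pt S → Pt T
apply {S} f x t = Affine.b f t + sumℚ (map (λ s → Affine.A f t s * x s) (coords S))

Aff : (S : Space) → (Pt S → Set) → Pt S → Set
Aff S P x = Σ (List (ℚ × Pt S)) λ l →
    (∀ c p → (c , p) ∈ l → P p)
  × (sumℚ (map (λ { (c , p) → c }) l) ≡ 1ℚ)
  × (∀ e → e ∈ coords S → x e ≡ sumℚ (map (λ { (c , p) → c * p e }) l))

IntAff : (S : Space) → (Pt S → Set) → Pt S → Set
IntAff S P x = Aff S P x × IsIntPt S x

BijOn : (S T : Space) → Affine S T → (Pt S → Set) → (Pt T → Set) → Set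
BijOn S T f P Q =
    (∀ x → P x → Q (apply f x))
  × (∀ x y → P x → P y → _≈[_]_ {T} (apply f x) T (apply f y) → _≈[_]_ {S} x S y)
  × (∀ y → Q y → ∃ λ x → P x × _≈[_]_ {T} (apply f x) T y)

IntEquiv : (S T : Space) → (Pt S → Set) → (Pt T → Set) → Set
IntEquiv S T P Q = Σ (Affine S T) λ f →
  BijOn S T f P Q × BijOn S T f (IntAff S P) (IntAff T Q)

-- Partitions: a partition with k parts is p 1 ≥ p 2 ≥ … ≥ p k ≥ 0
-- (values p j for j outside 1..k are never used)

IsPartition : ℕ → (ℕ → ℕ) → Set
IsPartition k p = ∀ j → 1 ≤ j → suc j ≤ k → p (suc j) ≤ p j

-- Gelfand–Tsetlin polytopes.  Arrays y : ℕ × ℕ → ℚ, entries y (i , j)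
-- with 1 ≤ i ≤ j ≤ k are the coordinates.

GT : (k : ℕ) → (ℕ → ℕ) → (ℕ × ℕ → ℚ) → Set
GT k p y =
    (∀ i j → 1 ≤ i → i ≤ j → j ≤ k → 0ℚ ≤ℚ y (i , j))
  × (∀ j → 1 ≤ j → j ≤ k → y (1 , j) ≡ ℕ→ℚ (p j))
  × (∀ i j → 2 ≤ i → i ≤ j → j ≤ k →
        (y (i , j) ≤ℚ y (i ∸ 1 , j ∸ 1)) × (y (i ∸ 1 , j) ≤ℚ y (i , j)))

GTSp : ℕ → Space
GTSp n = record
  { Ix = ℕ × ℕ
  ; coords = concatMap (λ j → map (λ i → (i , j)) (between 1 j)) (between 1 n) }

embGT : (n k : ℕ) → (ℕ × ℕ → ℚ) → (ℕ × ℕ → ℚ)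
embGT n k y (i , j) = if ((n ∸ k) +ℕ i) ≤ᵇ j then y (i , j ∸ (n ∸ k)) else 0ℚ

-- Minkowski sum GT(λ^(1)) + ⋯ + GT(λ^(n)),  lam k = λ^(k)
GTSum : (n : ℕ) → (ℕ → ℕ → ℕ) → Pt (GTSp n) → Set
GTSum n lam x = Σ (ℕ → ℕ × ℕ → ℚ) λ ys →
    (∀ k → 1 ≤ k → k ≤ n → GT k (lam k) (ys k))
  × (∀ e → e ∈ coords (GTSp n) →
        x e ≡ sumℚ (map (λ k → embGT n k (ys k) e) (between 1 n)))

-- Flow networks G_λ (λ with k parts).
-- Edges: (vert , i , j) is the edge v_ij → v_{i+1,j};
--        (diag , i , j) is the edge v_ij → v_{i+1,j+1}.

data Tag : Set where
  vert diag : Tag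

EIx : Set
EIx = Tag × ℕ × ℕ

validE : ℕ → Tag → ℕ → ℕ → Bool
validE k vert i j = (2 ≤ᵇ i ∧ i ≤ᵇ j ∧ j ≤ᵇ k) ∨ (j ≡ᵇ suc k ∧ 3 ≤ᵇ i ∧ i ≤ᵇ suc k)
validE k diag i j = (2 ≤ᵇ i ∧ i ≤ᵇ j ∧ j ≤ᵇ k) ∨ (suc j ≡ᵇ i ∧ 3 ≤ᵇ i ∧ i ≤ᵇ suc k)

isVertex : ℕ → ℕ → ℕ → Bool
isVertex k i j = (2 ≤ᵇ i ∧ i ≤ᵇ j ∧ j ≤ᵇ k)
               ∨ (suc j ≡ᵇ i ∧ 3 ≤ᵇ i ∧ i ≤ᵇ (k +ℕ 2))
               ∨ (j ≡ᵇ suc k ∧ 3 ≤ᵇ i ∧ i ≤ᵇ suc k)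

netflow : ℕ → (ℕ → ℕ) → ℕ → ℕ → ℚ
netflow k p i j =
  if (i ≡ᵇ 2 ∧ 2 ≤ᵇ j ∧ j ≤ᵇ k) then ℕ→ℚ (p (j ∸ 1)) - ℕ→ℚ (p j)
  else (if (i ≡ᵇ (k +ℕ 2) ∧ j ≡ᵇ suc k) then ℕ→ℚ (p k) - ℕ→ℚ (p 1) else 0ℚ)

val : ℕ → (EIx → ℚ) → Tag → ℕ → ℕ → ℚ
val k f t i j = if validE k t i j then f (t , i , j) else 0ℚ

inflow : ℕ → (EIx → ℚ) → ℕ → ℕ → ℚ
inflow k f i j = val k f vert (i ∸ 1) j + val k f diag (i ∸ 1) (j ∸ 1)

outflow : ℕ → (EIx → ℚ) → ℕ → ℕ → ℚ
outflow k f i j = val k f vert i j + val k f diag i j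

Flow : (k : ℕ) → (ℕ → ℕ) → (EIx → ℚ) → Set
Flow k p f =
    (∀ t i j → T (validE k t i j) → 0ℚ ≤ℚ f (t , i , j))
  × (∀ i j → T (isVertex k i j) →
        inflow k f i j + netflow k p i j ≡ outflow k f i j)

FSp : ℕ → Space
FSp k = record
  { Ix = EIx
  ; coords = filterᵇ (λ { (t , i , j) → validE k t i j })
      (concatMap (λ t → concatMap (λ i → map (λ j → (t , i , j)) (upTo (k +ℕ 3)))
                                  (upTo (k +ℕ 3)))
                 (vert ∷ diag ∷ [])) }

embF : (n k : ℕ) → (EIx → ℚ) → (EIx → ℚ)
embF n k f (t , i , j) = if (n ∸ k) ≤ᵇ j then val k f t i (j ∸ (n ∸ k)) else 0ℚ

FSum : (n : ℕ) → (ℕ → ℕ → ℕ) → Pt (FSp n) → Set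
FSum n lam x = Σ (ℕ → EIx → ℚ) λ fs →
    (∀ k → 1 ≤ k → k ≤ n → Flow k (lam k) (fs k))
  × (∀ e → e ∈ coords (FSp n) →
        x e ≡ sumℚ (map (λ k → embF n k (fs k) e) (between 1 n)))

-- The affine map sends an array x to the vector of differences x_pos(e) - x_neg(e) of the two array
-- entries adjacent to each edge e, shifted by a constant. For a single GT(λ) this is the classical
-- bijection with F_{G_λ}: the GT inequalities say exactly that the differences are non-negative,
-- conservation at each vertex is a telescoping identity, and an array is recovered from a flow by
-- adding the diagonal flows down from its top row λ. The embeddings of GT(λ^(k)) and G_{λ^(k)}
-- commute with the map up to a constant, so by linearity the map carries the Minkowski sum onto the
-- Minkowski sum. All points of the affine hull share the same top row, and the diagonal differences
-- then determine the remaining rows; this gives injectivity, and the same recursion shows that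
-- integral flow vectors come from integral arrays.

module Submission where

open import Defs
open import Data.Nat using (ℕ; zero; suc; _∸_; _≤_; _<_; z≤n; s≤s; s≤s⁻¹) renaming (_+_ to _+ℕ_; _*_ to _*ℕ_)
import Data.Nat.Properties as ℕP
open import Data.Bool using (true; false; if_then_else_; _∧_; _∨_; T)
open import Data.Unit using (tt)
open import Data.Empty using (⊥; ⊥-elim)
open import Data.Sum using (_⊎_; inj₁; inj₂)
open import Data.Product using (Σ; ∃; _×_; _,_; proj₁; proj₂)
open import Data.List using (List; []; _∷_; _++_; map; upTo; applyUpTo; concatMap)
open import Data.List.Membership.Propositional using (_∈_; lose; find)
open import Data.List.Membership.Propositional.Properties
  using (∈-map⁺; ∈-map⁻; ∈-applyUpTo⁻; ∈-upTo⁺; ∈-upTo⁻; ∈-concatMap⁺; ∈-concatMap⁻;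
         ∈-filter⁺; ∈-filter⁻)
open import Data.List.Relation.Unary.Any using (here; there)
open import Data.Integer using (ℤ; +_; -[1+_])
import Data.Integer as ℤ
import Data.Integer.Properties as ℤP
open import Data.Rational using (ℚ; 0ℚ; 1ℚ; _+_; _*_; _-_; -_; mkℚ) renaming (_≤_ to _≤ℚ_)
import Data.Rational as ℚ
import Data.Rational.Properties as ℚP
open import Data.Rational.Solver using (module +-*-Solver)
open +-*-Solver
open import Relation.Binary.PropositionalEquality
open import Relation.Nullary using (¬_; Dec; yes; no)
open import Relation.Binary.Definitions using (Tri; tri<; tri≈; tri>)
open import Relation.Nullary.Decidable using (T?)
open import Function using (_∘_)

T-∧-intro : ∀ {a b} → T a → T b → T (a ∧ b)
T-∧-intro {true} {true} _ _ = tt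

T-∨-injˡ : ∀ {a b} → T a → T (a ∨ b)
T-∨-injˡ {true} _ = tt

T-∨-injʳ : ∀ {a b} → T b → T (a ∨ b)
T-∨-injʳ {true} _ = tt
T-∨-injʳ {false} p = p

T-∨-elim : ∀ {a b} → T (a ∨ b) → T a ⊎ T b
T-∨-elim {true} _ = inj₁ tt
T-∨-elim {false} p = inj₂ p

¬T-∧ˡ : ∀ {a b} → ¬ T a → ¬ T (a ∧ b)
¬T-∧ˡ {true} ¬a _ = ¬a tt

¬T-∧ʳ : ∀ {a b} → ¬ T b → ¬ T (a ∧ b)
¬T-∧ʳ {true} ¬b = ¬b

if-true : ∀ {A : Set} {b} {x y : A} → T b → (if b then x else y) ≡ x
if-true {b = true} _ = refl

if-false : ∀ {A : Set} {b} {x y : A} → ¬ T b → (if b then x else y) ≡ y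
if-false {b = true} ¬b = ⊥-elim (¬b tt)
if-false {b = false} _ = refl

if-cong-then : ∀ {A : Set} b {x x' z : A} → (T b → x ≡ x') →
               (if b then x else z) ≡ (if b then x' else z)
if-cong-then true eq = eq tt
if-cong-then false _ = refl

≤⇒T : ∀ {m n} → m ≤ n → T (m ≤ᵇ n)
≤⇒T = ℕP.≤⇒≤ᵇ

T⇒≤ : ∀ {m n} → T (m ≤ᵇ n) → m ≤ n
T⇒≤ {m} {n} = ℕP.≤ᵇ⇒≤ m n

>⇒¬T≤ : ∀ {m n} → n < m → ¬ T (m ≤ᵇ n)
>⇒¬T≤ n<m = ℕP.<⇒≱ n<m ∘ T⇒≤

≡⇒T : ∀ {m n} → m ≡ n → T (m ≡ᵇ n)
≡⇒T {m} {n} = ℕP.≡⇒≡ᵇ m n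

T⇒≡ : ∀ {m n} → T (m ≡ᵇ n) → m ≡ n
T⇒≡ {m} {n} = ℕP.≡ᵇ⇒≡ m n

≢⇒¬T≡ : ∀ {m n} → m ≢ n → ¬ T (m ≡ᵇ n)
≢⇒¬T≡ m≢n = m≢n ∘ T⇒≡

T-∧₃ : ∀ {a b c} → T (a ∧ b ∧ c) → T a × T b × T c
T-∧₃ {true} {true} abc = tt , tt , abc

T-∧₃-intro : ∀ {a b c} → T a → T b → T c → T (a ∧ b ∧ c)
T-∧₃-intro {true} {true} _ _ c = c

≤⇒≢1+ : ∀ {a b} → a ≤ b → a ≢ suc b
≤⇒≢1+ a≤b refl = ℕP.1+n≰n a≤b

m+n≤o⇒n≤o∸m : ∀ m {n o} → m +ℕ n ≤ o → n ≤ o ∸ m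
m+n≤o⇒n≤o∸m m {n} {o} m+n≤o = ℕP.m+n≤o⇒m≤o∸n n (subst (_≤ o) (ℕP.+-comm m n) m+n≤o)

n≤o∸m⇒m+n≤o : ∀ {m n o} → m ≤ o → n ≤ o ∸ m → m +ℕ n ≤ o
n≤o∸m⇒m+n≤o {m} {n} {o} m≤o n≤o∸m = subst (_≤ o) (ℕP.+-comm n m) (ℕP.m≤o∸n⇒m+n≤o n m≤o n≤o∸m)

∸-∸-comm : ∀ m n o → (m ∸ n) ∸ o ≡ (m ∸ o) ∸ n
∸-∸-comm m n o = trans (ℕP.∸-+-assoc m n o) (trans (cong (m ∸_) (ℕP.+-comm n o)) (sym (ℕP.∸-+-assoc m o n)))

private
  1+m*n≡1 : ∀ d g → (+ suc d) ℤ.* (+ g) ≡ + 1 → (d ≡ 0) × (g ≡ 1)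
  1+m*n≡1 d g eq = ℕP.suc-injective (ℕP.m*n≡1⇒m≡1 (suc d) g eq′) , ℕP.m*n≡1⇒n≡1 (suc d) g eq′
    where
    eq′ : suc d *ℕ g ≡ 1
    eq′ = ℤP.+-injective (trans (ℤP.pos-* (suc d) g) eq)

IsInt-/1 : ∀ z → IsInt (z ℚ./ 1)
IsInt-/1 z with z ℚ./ 1 | ℚP.↧-/ z 1
... | mkℚ _ d _ | eq = proj₁ (1+m*n≡1 d _ eq)

IsInt-+ : ∀ {p q} → IsInt p → IsInt q → IsInt (p + q)
IsInt-+ {mkℚ a zero _} {mkℚ b zero _} refl refl = IsInt-/1 (a ℤ.* + 1 ℤ.+ b ℤ.* + 1)

IsInt-neg : ∀ {p} → IsInt p → IsInt (- p)
IsInt-neg {mkℚ (+ zero) zero _} refl = refl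
IsInt-neg {mkℚ (+ suc _) zero _} refl = refl
IsInt-neg {mkℚ -[1+ _ ] zero _} refl = refl

IsInt-minus : ∀ {p q} → IsInt p → IsInt q → IsInt (p - q)
IsInt-minus {p} {q} p∈ℤ q∈ℤ = IsInt-+ {p} { - q} p∈ℤ (IsInt-neg {q} q∈ℤ)

IsInt-ℕ→ℚ : ∀ m → IsInt (ℕ→ℚ m)
IsInt-ℕ→ℚ m = IsInt-/1 (+ m)

0≤ℕ→ℚ : ∀ m → 0ℚ ≤ℚ ℕ→ℚ m
0≤ℕ→ℚ m = ℚP.nonNegative⁻¹ (ℕ→ℚ m) {{ℚP.normalize-nonNeg m 1}}

0≤p-q : ∀ {p q} → q ≤ℚ p → 0ℚ ≤ℚ p - q
0≤p-q {p} {q} q≤p = subst (_≤ℚ p - q) (ℚP.+-inverseʳ q) (ℚP.+-monoˡ-≤ (- q) q≤p)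

0≤p-q⇒q≤p : ∀ {p q} → 0ℚ ≤ℚ p - q → q ≤ℚ p
0≤p-q⇒q≤p {p} {q} 0≤p-q = subst₂ _≤ℚ_ (ℚP.+-identityˡ q)
  (solve 2 (λ p q → (p :- q) :+ q := p) refl p q) (ℚP.+-monoˡ-≤ q 0≤p-q)

p≤p+q : ∀ {p q} → 0ℚ ≤ℚ q → p ≤ℚ p + q
p≤p+q {p} {q} 0≤q = subst (_≤ℚ p + q) (ℚP.+-identityʳ p) (ℚP.+-monoʳ-≤ p 0≤q)

p≡q+r⇒q≡p-r : ∀ {p q r} → p ≡ q + r → q ≡ p - r
p≡q+r⇒q≡p-r {p} {q} {r} p≡q+r = trans (solve 2 (λ q r → q := (q :+ r) :- r) refl q r) (cong (_- r) (sym p≡q+r))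

module _ {A : Set} where

  sumℚ-cong : (l : List A) {g h : A → ℚ} → (∀ a → a ∈ l → g a ≡ h a) →
              sumℚ (map g l) ≡ sumℚ (map h l)
  sumℚ-cong [] _ = refl
  sumℚ-cong (x ∷ l) eq = cong₂ _+_ (eq x (here refl)) (sumℚ-cong l (λ a a∈l → eq a (there a∈l)))

  sumℚ-+ : (l : List A) (g h : A → ℚ) →
           sumℚ (map (λ a → g a + h a) l) ≡ sumℚ (map g l) + sumℚ (map h l)
  sumℚ-+ [] g h = refl
  sumℚ-+ (x ∷ l) g h = trans (cong (_+_ (g x + h x)) (sumℚ-+ l g h))
    (solve 4 (λ a b c d → (a :+ b) :+ (c :+ d) := (a :+ c) :+ (b :+ d)) refl
           (g x) (h x) (sumℚ (map g l)) (sumℚ (map h l)))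

  sumℚ-minus : (l : List A) (g h : A → ℚ) →
               sumℚ (map (λ a → g a - h a) l) ≡ sumℚ (map g l) - sumℚ (map h l)
  sumℚ-minus [] g h = refl
  sumℚ-minus (x ∷ l) g h = trans (cong (_+_ (g x - h x)) (sumℚ-minus l g h))
    (solve 4 (λ a b c d → (a :- b) :+ (c :- d) := (a :+ c) :- (b :+ d)) refl
           (g x) (h x) (sumℚ (map g l)) (sumℚ (map h l)))

  sumℚ-*ˡ : (l : List A) (c : ℚ) (g : A → ℚ) →
            sumℚ (map (λ a → c * g a) l) ≡ c * sumℚ (map g l)
  sumℚ-*ˡ [] c g = sym (ℚP.*-zeroʳ c)
  sumℚ-*ˡ (x ∷ l) c g = trans (cong (_+_ (c * g x)) (sumℚ-*ˡ l c g))
    (solve 3 (λ c a b → c :* a :+ c :* b := c :* (a :+ b)) refl c (g x) (sumℚ (map g l)))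

  sumℚ-*ʳ : (l : List A) (c : ℚ) (g : A → ℚ) →
            sumℚ (map (λ a → g a * c) l) ≡ sumℚ (map g l) * c
  sumℚ-*ʳ [] c g = sym (ℚP.*-zeroˡ c)
  sumℚ-*ʳ (x ∷ l) c g = trans (cong (_+_ (g x * c)) (sumℚ-*ʳ l c g))
    (solve 3 (λ c a b → a :* c :+ b :* c := (a :+ b) :* c) refl c (g x) (sumℚ (map g l)))

  sumℚ-zero : (l : List A) (g : A → ℚ) → (∀ a → a ∈ l → g a ≡ 0ℚ) → sumℚ (map g l) ≡ 0ℚ
  sumℚ-zero l g g≡0 = trans (sumℚ-cong l g≡0) (zeros l)
    where
    zeros : (l : List A) → sumℚ (map (λ _ → 0ℚ) l) ≡ 0ℚ
    zeros [] = refl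
    zeros (_ ∷ l) = trans (ℚP.+-identityˡ _) (zeros l)

  IsInt-sumℚ : (l : List A) (g : A → ℚ) → (∀ a → a ∈ l → IsInt (g a)) → IsInt (sumℚ (map g l))
  IsInt-sumℚ [] g _ = refl
  IsInt-sumℚ (x ∷ l) g g∈ℤ =
    IsInt-+ {g x} {sumℚ (map g l)} (g∈ℤ x (here refl)) (IsInt-sumℚ l g (λ a a∈l → g∈ℤ a (there a∈l)))

module _ {A B : Set} where

  sumℚ-++ : (g : B → ℚ) (l l' : List B) → sumℚ (map g (l ++ l')) ≡ sumℚ (map g l) + sumℚ (map g l')
  sumℚ-++ g [] l' = sym (ℚP.+-identityˡ _)
  sumℚ-++ g (x ∷ l) l' = trans (cong (_+_ (g x)) (sumℚ-++ g l l')) (sym (ℚP.+-assoc (g x) _ _))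

  sumℚ-concatMap : (g : B → ℚ) (h : A → List B) (l : List A) →
                   sumℚ (map g (concatMap h l)) ≡ sumℚ (map (λ a → sumℚ (map g (h a))) l)
  sumℚ-concatMap g h [] = refl
  sumℚ-concatMap g h (x ∷ l) =
    trans (sumℚ-++ g (h x) (concatMap h l)) (cong (_+_ (sumℚ (map g (h x)))) (sumℚ-concatMap g h l))

  sumℚ-map : (g : B → ℚ) (f : A → B) (l : List A) → sumℚ (map g (map f l)) ≡ sumℚ (map (g ∘ f) l)
  sumℚ-map g f [] = refl
  sumℚ-map g f (x ∷ l) = cong (_+_ (g (f x))) (sumℚ-map g f l)

-- Affine maps preserve affine hulls

combination : ∀ {I : Set} → List (ℚ × (I → ℚ)) → I → ℚ
combination l s = sumℚ (map (λ a → proj₁ a * proj₂ a s) l)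

sumℚ-*-combination : ∀ {A : Set} (ss : List A) (w : A → ℚ) (l : List (ℚ × (A → ℚ))) →
  sumℚ (map (λ s → w s * combination l s) ss) ≡
  sumℚ (map (λ a → proj₁ a * sumℚ (map (λ s → w s * proj₂ a s) ss)) l)
sumℚ-*-combination ss w [] = sumℚ-zero ss _ (λ s _ → ℚP.*-zeroʳ (w s))
sumℚ-*-combination ss w ((c , p) ∷ l) = begin
  sumℚ (map (λ s → w s * (c * p s + combination l s)) ss)
    ≡⟨ sumℚ-cong ss (λ s _ → solve 4 (λ w c p r → w :* (c :* p :+ r) := c :* (w :* p) :+ w :* r) refl
                                    (w s) c (p s) (combination l s)) ⟩
  sumℚ (map (λ s → c * (w s * p s) + w s * combination l s) ss)
    ≡⟨ sumℚ-+ ss _ _ ⟩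
  sumℚ (map (λ s → c * (w s * p s)) ss) + sumℚ (map (λ s → w s * combination l s) ss)
    ≡⟨ cong₂ _+_ (sumℚ-*ˡ ss c (λ s → w s * p s)) (sumℚ-*-combination ss w l) ⟩
  c * sumℚ (map (λ s → w s * p s) ss) +
  sumℚ (map (λ a → proj₁ a * sumℚ (map (λ s → w s * proj₂ a s) ss)) l) ∎
  where open ≡-Reasoning

module _ {S T : Space} (f : Affine S T) where

  image : List (ℚ × Pt S) → List (ℚ × Pt T)
  image = map (λ a → (proj₁ a , apply f (proj₂ a)))

  apply-cong : ∀ {x x′} → (∀ s → s ∈ coords S → x s ≡ x′ s) → ∀ t → apply f x t ≡ apply f x′ t
  apply-cong x≈x′ t =
    cong (_+_ (Affine.b f t)) (sumℚ-cong (coords S) (λ s s∈ → cong (Affine.A f t s *_) (x≈x′ s s∈)))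

  apply-combination : ∀ l → sumℚ (map proj₁ l) ≡ 1ℚ → ∀ t → apply f (combination l) t ≡ combination (image l) t
  apply-combination l Σc≡1 t = begin
    b + sumℚ (map (λ s → Affine.A f t s * combination l s) (coords S))
      ≡⟨ cong₂ _+_ (sym (trans (sumℚ-*ʳ l b proj₁) (trans (cong (_* b) Σc≡1) (ℚP.*-identityˡ b))))
                   (sumℚ-*-combination (coords S) (Affine.A f t) l) ⟩
    sumℚ (map (λ a → proj₁ a * b) l) + sumℚ (map (λ a → proj₁ a * Y a) l)
      ≡⟨ sym (sumℚ-+ l _ _) ⟩
    sumℚ (map (λ a → proj₁ a * b + proj₁ a * Y a) l)
      ≡⟨ sumℚ-cong l (λ a _ → sym (ℚP.*-distribˡ-+ (proj₁ a) b (Y a))) ⟩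
    sumℚ (map (λ a → proj₁ a * apply f (proj₂ a) t) l)
      ≡⟨ sym (sumℚ-map (λ a → proj₁ a * proj₂ a t) (λ a → (proj₁ a , apply f (proj₂ a))) l) ⟩
    combination (image l) t ∎
    where
    open ≡-Reasoning
    b = Affine.b f t
    Y = λ a → sumℚ (map (λ s → Affine.A f t s * proj₂ a s) (coords S))

  module _ {P : Pt S → Set} {Q : Pt T → Set} where

    Aff-image : (∀ x → P x → Q (apply f x)) → ∀ x → Aff S P x → Aff T Q (apply f x)
    Aff-image into x (l , l⊆P , Σc≡1 , x≈) =
      image l , image⊆Q , trans (sumℚ-map proj₁ _ l) Σc≡1 ,
      (λ t _ → trans (apply-cong x≈ t) (apply-combination l Σc≡1 t))
      where
      image⊆Q : ∀ c q → (c , q) ∈ image l → Q q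
      image⊆Q c q cq∈ with ∈-map⁻ (λ a → (proj₁ a , apply f (proj₂ a))) cq∈
      ... | (c′ , p) , cp∈ , refl = into p (l⊆P c′ p cp∈)

    module _ (onto : ∀ y → Q y → ∃ λ x → P x × (∀ t → t ∈ coords T → apply f x t ≡ y t)) where

      lift-combination : (l : List (ℚ × Pt T)) → (∀ c q → (c , q) ∈ l → Q q) →
        Σ (List (ℚ × Pt S)) λ l′ → (∀ c p → (c , p) ∈ l′ → P p)
                                   × (sumℚ (map proj₁ l′) ≡ sumℚ (map proj₁ l))
                                   × (∀ t → t ∈ coords T → combination (image l′) t ≡ combination l t)
      lift-combination [] _ = [] , (λ _ _ ()) , refl , (λ _ _ → refl)
      lift-combination ((c , q) ∷ l) cl⊆Q
        with onto q (cl⊆Q c q (here refl)) | lift-combination l (λ c′ q′ → cl⊆Q c′ q′ ∘ there)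
      ... | p , Pp , fp≈q | l′ , l′⊆P , Σ≡ , image≈ =
          (c , p) ∷ l′
        , (λ { c′ p′ (here refl) → Pp ; c′ p′ (there cp∈) → l′⊆P c′ p′ cp∈ })
        , cong (_+_ c) Σ≡
        , (λ t t∈ → cong₂ _+_ (cong (c *_) (fp≈q t t∈)) (image≈ t t∈))

      Aff-preimage : ∀ y → Aff T Q y → ∃ λ x → Aff S P x × (∀ t → t ∈ coords T → apply f x t ≡ y t)
      Aff-preimage y (l , l⊆Q , Σc≡1 , y≈) with lift-combination l l⊆Q
      ... | l′ , l′⊆P , Σc′≡Σc , image≈ =
        combination l′ , (l′ , l′⊆P , Σc′≡1 , λ _ _ → refl) ,
        (λ t t∈ → trans (apply-combination l′ Σc′≡1 t) (trans (image≈ t t∈) (sym (y≈ t t∈))))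
        where Σc′≡1 = trans Σc′≡Σc Σc≡1

map-applyUpTo : ∀ {A B : Set} (h : A → B) (f : ℕ → A) m → map h (applyUpTo f m) ≡ applyUpTo (h ∘ f) m
map-applyUpTo h f zero = refl
map-applyUpTo h f (suc m) = cong (h (f 0) ∷_) (map-applyUpTo h (f ∘ suc) m)

between≡applyUpTo : ∀ lo hi → between lo hi ≡ applyUpTo (lo +ℕ_) (suc hi ∸ lo)
between≡applyUpTo lo hi = map-applyUpTo (lo +ℕ_) (λ i → i) (suc hi ∸ lo)

∈-between⁺ : ∀ {lo hi a} → lo ≤ a → a ≤ hi → a ∈ between lo hi
∈-between⁺ {lo} {hi} lo≤a a≤hi =
  subst (_∈ between lo hi) (ℕP.m+[n∸m]≡n lo≤a)
    (∈-map⁺ (lo +ℕ_) (∈-upTo⁺ (ℕP.∸-monoˡ-< (s≤s a≤hi) lo≤a)))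

∈-between⁻ : ∀ {lo hi a} → a ∈ between lo hi → lo ≤ a × a ≤ hi
∈-between⁻ {lo} {hi} a∈ with ∈-map⁻ (lo +ℕ_) a∈
... | i , i∈ , refl = ℕP.m≤m+n lo i , s≤s⁻¹ lo+i<1+hi
  where
  i< : i < suc hi ∸ lo
  i< = ∈-upTo⁻ i∈
  lo+i<1+hi : lo +ℕ i < suc hi
  lo+i<1+hi with ℕP.≤-total lo (suc hi)
  ... | inj₁ lo≤ = subst (lo +ℕ i <_) (ℕP.m+[n∸m]≡n lo≤) (ℕP.+-monoʳ-< lo i<)
  ... | inj₂ lo≥ = ⊥-elim (ℕP.n≮0 (subst (i <_) (ℕP.m≤n⇒m∸n≡0 lo≥) i<))

select : ℕ → (ℕ → ℚ) → ℕ → ℚ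
select c g x = if c ≡ᵇ x then g x else 0ℚ

sumℚ-select-applyUpTo : ∀ c g (f : ℕ → ℕ) m i₀ → (∀ {i i'} → f i ≡ f i' → i ≡ i') →
  i₀ < m → f i₀ ≡ c → sumℚ (map (select c g) (applyUpTo f m)) ≡ g c
sumℚ-select-applyUpTo c g f (suc m) zero f-inj _ refl =
  trans (cong₂ _+_ (if-true (≡⇒T {f 0} refl)) tail≡0) (ℚP.+-identityʳ _)
  where
  tail≡0 : sumℚ (map (select c g) (applyUpTo (f ∘ suc) m)) ≡ 0ℚ
  tail≡0 = sumℚ-zero _ _ λ x x∈ → case (∈-applyUpTo⁻ (f ∘ suc) x∈)
    where
    case : ∀ {x} → ∃ (λ i → i < m × x ≡ f (suc i)) → select c g x ≡ 0ℚ
    case (i , _ , refl) = if-false (≢⇒¬T≡ {c} (λ eq → ℕP.0≢1+n (f-inj eq)))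
sumℚ-select-applyUpTo c g f (suc m) (suc i₀) f-inj i₀< f-i₀ =
  trans (cong₂ _+_ (if-false (≢⇒¬T≡ {c} (λ eq → ℕP.0≢1+n (f-inj (trans (sym eq) (sym f-i₀))))))
                   (sumℚ-select-applyUpTo c g (f ∘ suc) m i₀ (ℕP.suc-injective ∘ f-inj) (s≤s⁻¹ i₀<) f-i₀))
        (ℚP.+-identityˡ _)

sumℚ-select-between : ∀ {lo hi c} g → lo ≤ c → c ≤ hi → sumℚ (map (select c g) (between lo hi)) ≡ g c
sumℚ-select-between {lo} {hi} {c} g lo≤c c≤hi =
  trans (cong (sumℚ ∘ map (select c g)) (between≡applyUpTo lo hi))
    (sumℚ-select-applyUpTo c g (lo +ℕ_) (suc hi ∸ lo) (c ∸ lo) (ℕP.+-cancelˡ-≡ lo _ _)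
      (ℕP.∸-monoˡ-< (s≤s c≤hi) lo≤c) (ℕP.m+[n∸m]≡n lo≤c))

InTriangle : ℕ → ℕ × ℕ → Set
InTriangle n (a , b) = 1 ≤ a × a ≤ b × b ≤ n

∈-GTSp⁺ : ∀ n {s} → InTriangle n s → s ∈ coords (GTSp n)
∈-GTSp⁺ n {a , b} (1≤a , a≤b , b≤n) =
  ∈-concatMap⁺ (λ j → map (λ i → (i , j)) (between 1 j))
    (lose (∈-between⁺ (ℕP.≤-trans 1≤a a≤b) b≤n) (∈-map⁺ (λ i → (i , b)) (∈-between⁺ 1≤a a≤b)))

∈-GTSp⁻ : ∀ n {s} → s ∈ coords (GTSp n) → InTriangle n s
∈-GTSp⁻ n s∈ with find (∈-concatMap⁻ (λ j → map (λ i → (i , j)) (between 1 j)) {xs = between 1 n} s∈)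
... | j , j∈ , s∈col with ∈-map⁻ (λ i → (i , j)) s∈col
... | i , i∈ , refl = proj₁ (∈-between⁻ i∈) , proj₂ (∈-between⁻ i∈) , proj₂ (∈-between⁻ j∈)

δ : ℕ × ℕ → ℕ × ℕ → ℚ
δ (a , b) (i , j) = if (b ≡ᵇ j) ∧ (a ≡ᵇ i) then 1ℚ else 0ℚ

sumℚ-δ : ∀ n (x : ℕ × ℕ → ℚ) {s₀} → InTriangle n s₀ →
         sumℚ (map (λ s → δ s₀ s * x s) (coords (GTSp n))) ≡ x s₀
sumℚ-δ n x {a , b} (1≤a , a≤b , b≤n) =
  trans (sumℚ-concatMap (λ s → δ (a , b) s * x s) (λ j → map (λ i → (i , j)) (between 1 j)) (between 1 n))
    (trans (sumℚ-cong (between 1 n) (λ j _ → trans (sumℚ-map _ (λ i → (i , j)) (between 1 j)) (column j)))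
           (sumℚ-select-between (λ _ → x (a , b)) (ℕP.≤-trans 1≤a a≤b) b≤n))
  where
  column : ∀ j → sumℚ (map (λ i → δ (a , b) (i , j) * x (i , j)) (between 1 j)) ≡ select b (λ _ → x (a , b)) j
  column j with b ℕP.≟ j
  ... | yes refl = trans (sumℚ-cong (between 1 b) entry)
                         (trans (sumℚ-select-between (λ i → x (i , b)) 1≤a a≤b) (sym (if-true (≡⇒T {b} refl))))
    where
    entry : ∀ i → i ∈ between 1 b → δ (a , b) (i , b) * x (i , b) ≡ select a (λ i → x (i , b)) i
    entry i _ with a ℕP.≟ i
    ... | yes refl = trans (cong (_* x (a , b)) (if-true (T-∧-intro (≡⇒T {b} refl) (≡⇒T {a} refl))))
                           (trans (ℚP.*-identityˡ (x (a , b))) (sym (if-true (≡⇒T {a} refl))))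
    ... | no a≢i = trans (cong (_* x (i , b)) (if-false (¬T-∧ʳ {b ≡ᵇ b} (≢⇒¬T≡ a≢i))))
                         (trans (ℚP.*-zeroˡ (x (i , b))) (sym (if-false (≢⇒¬T≡ a≢i))))
  ... | no b≢j = trans (sumℚ-zero (between 1 j) _
                         (λ i _ → trans (cong (_* x (i , j)) (if-false (¬T-∧ˡ (≢⇒¬T≡ b≢j))))
                                        (ℚP.*-zeroˡ (x (i , j)))))
                       (sym (if-false (≢⇒¬T≡ b≢j)))

-- The graph G_λ and its flows

-- Besides the edges inside the triangle, G_λ has the vertical edges v_{i,k+1} → v_{i+1,k+1} (right)
-- and the diagonal edges v_{j+1,j} → v_{j+2,j+1} below the triangle (lower).
data Edge (k : ℕ) : Tag → ℕ → ℕ → Set where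
  inner : ∀ t {i j} → 2 ≤ i → i ≤ j → j ≤ k → Edge k t i j
  right : ∀ {i} → 3 ≤ i → i ≤ suc k → Edge k vert i (suc k)
  lower : ∀ {j} → 2 ≤ j → j ≤ k → Edge k diag (suc j) j

data Vertex (k : ℕ) : ℕ → ℕ → Set where
  inner : ∀ {i j} → 2 ≤ i → i ≤ j → j ≤ k → Vertex k i j
  lower : ∀ {j} → 2 ≤ j → j ≤ suc k → Vertex k (suc j) j
  right : ∀ {i} → 3 ≤ i → i ≤ suc k → Vertex k i (suc k)

private
  T-≤₃ : ∀ {a b c d} → T (a ≤ᵇ b ∧ b ≤ᵇ c ∧ c ≤ᵇ d) → a ≤ b × b ≤ c × c ≤ d
  T-≤₃ abcd with T-∧₃ abcd
  ... | ab , bc , cd = T⇒≤ ab , T⇒≤ bc , T⇒≤ cd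

  ≤₃-T : ∀ {a b c d} → a ≤ b → b ≤ c → c ≤ d → T (a ≤ᵇ b ∧ b ≤ᵇ c ∧ c ≤ᵇ d)
  ≤₃-T ab bc cd = T-∧₃-intro (≤⇒T ab) (≤⇒T bc) (≤⇒T cd)

validE⇒Edge : ∀ {k t i j} → T (validE k t i j) → Edge k t i j
validE⇒Edge {k} {vert} {i} {j} valid with T-∨-elim {2 ≤ᵇ i ∧ i ≤ᵇ j ∧ j ≤ᵇ k} valid
... | inj₁ c with T-≤₃ c
...   | 2≤i , i≤j , j≤k = inner vert 2≤i i≤j j≤k
validE⇒Edge {k} {vert} {i} {j} valid | inj₂ c with T-∧₃ {j ≡ᵇ suc k} {3 ≤ᵇ i} {i ≤ᵇ suc k} c
...   | j≡ , 3≤i , i≤ with T⇒≡ {j} {suc k} j≡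
...     | refl = right (T⇒≤ {3} 3≤i) (T⇒≤ {i} i≤)
validE⇒Edge {k} {diag} {i} {j} valid with T-∨-elim {2 ≤ᵇ i ∧ i ≤ᵇ j ∧ j ≤ᵇ k} valid
... | inj₁ c with T-≤₃ c
...   | 2≤i , i≤j , j≤k = inner diag 2≤i i≤j j≤k
validE⇒Edge {k} {diag} {i} {j} valid | inj₂ c with T-∧₃ {suc j ≡ᵇ i} {3 ≤ᵇ i} {i ≤ᵇ suc k} c
...   | i≡ , 3≤i , i≤ with T⇒≡ {suc j} {i} i≡
...     | refl = lower (s≤s⁻¹ (T⇒≤ {3} 3≤i)) (s≤s⁻¹ (T⇒≤ {suc j} i≤))

Edge⇒validE : ∀ {k t i j} → Edge k t i j → T (validE k t i j)
Edge⇒validE (inner vert 2≤i i≤j j≤k) = T-∨-injˡ (≤₃-T 2≤i i≤j j≤k)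
Edge⇒validE (inner diag 2≤i i≤j j≤k) = T-∨-injˡ (≤₃-T 2≤i i≤j j≤k)
Edge⇒validE {k} {i = i} (right 3≤i i≤) =
  T-∨-injʳ {2 ≤ᵇ i ∧ i ≤ᵇ suc k ∧ suc k ≤ᵇ k} (T-∧₃-intro (≡⇒T {suc k} refl) (≤⇒T 3≤i) (≤⇒T i≤))
Edge⇒validE {k} {j = j} (lower 2≤j j≤k) =
  T-∨-injʳ {2 ≤ᵇ suc j ∧ suc j ≤ᵇ j ∧ j ≤ᵇ k}
    (T-∧₃-intro (≡⇒T {suc j} refl) (≤⇒T (s≤s 2≤j)) (≤⇒T (s≤s j≤k)))

Edge-bounds : ∀ {k t i j} → Edge k t i j → i ≤ suc k × j ≤ suc k
Edge-bounds (inner _ _ i≤j j≤k) = ℕP.≤-trans i≤j (ℕP.m≤n⇒m≤1+n j≤k) , ℕP.m≤n⇒m≤1+n j≤k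
Edge-bounds (right _ i≤) = i≤ , ℕP.≤-refl
Edge-bounds (lower _ j≤k) = s≤s j≤k , ℕP.m≤n⇒m≤1+n j≤k

∈-FSp⁺ : ∀ n {t i j} → Edge n t i j → (t , i , j) ∈ coords (FSp n)
∈-FSp⁺ n {t} {i} {j} e =
  ∈-filter⁺ (T? ∘ (λ { (t , i , j) → validE n t i j }))
    (∈-concatMap⁺ (λ t → concatMap (λ i → map (λ j → (t , i , j)) (upTo (n +ℕ 3))) (upTo (n +ℕ 3)))
      (lose (tag∈ t) (∈-concatMap⁺ (λ i → map (λ j → (t , i , j)) (upTo (n +ℕ 3))) (lose i∈ j∈))))
    (Edge⇒validE e)
  where
  <n+3 : ∀ {m} → m ≤ suc n → m < n +ℕ 3
  <n+3 {m} m≤ = subst (m <_) (ℕP.+-comm 3 n) (s≤s (ℕP.m≤n⇒m≤1+n m≤))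
  i∈ = ∈-upTo⁺ (<n+3 (proj₁ (Edge-bounds e)))
  j∈ = ∈-map⁺ (λ j → (t , i , j)) (∈-upTo⁺ (<n+3 (proj₂ (Edge-bounds e))))
  tag∈ : ∀ t → t ∈ vert ∷ diag ∷ []
  tag∈ vert = here refl
  tag∈ diag = there (here refl)

edgeCandidates : ℕ → List EIx
edgeCandidates n = concatMap (λ t → concatMap (λ i → map (λ j → (t , i , j)) (upTo (n +ℕ 3))) (upTo (n +ℕ 3)))
                             (vert ∷ diag ∷ [])

∈-FSp⁻ : ∀ n {t i j} → (t , i , j) ∈ coords (FSp n) → T (validE n t i j)
∈-FSp⁻ n e∈ = proj₂ (∈-filter⁻ (T? ∘ (λ { (t , i , j) → validE n t i j })) {xs = edgeCandidates n} e∈)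

isVertex⇒Vertex : ∀ {k i j} → T (isVertex k i j) → Vertex k i j
isVertex⇒Vertex {k} {i} {j} v with T-∨-elim {2 ≤ᵇ i ∧ i ≤ᵇ j ∧ j ≤ᵇ k} v
... | inj₁ c with T-≤₃ c
...   | 2≤i , i≤j , j≤k = inner 2≤i i≤j j≤k
isVertex⇒Vertex {k} {i} {j} v | inj₂ c with T-∨-elim {suc j ≡ᵇ i ∧ 3 ≤ᵇ i ∧ i ≤ᵇ (k +ℕ 2)} c
...   | inj₁ c′ with T-∧₃ {suc j ≡ᵇ i} {3 ≤ᵇ i} {i ≤ᵇ (k +ℕ 2)} c′
...     | i≡ , 3≤i , i≤ with T⇒≡ {suc j} {i} i≡
...       | refl = lower (s≤s⁻¹ (T⇒≤ {3} 3≤i)) (s≤s⁻¹ (subst (suc j ≤_) (ℕP.+-comm k 2) (T⇒≤ {suc j} i≤)))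
isVertex⇒Vertex {k} {i} {j} v | inj₂ c | inj₂ c′ with T-∧₃ {j ≡ᵇ suc k} {3 ≤ᵇ i} {i ≤ᵇ suc k} c′
...     | j≡ , 3≤i , i≤ with T⇒≡ {j} {suc k} j≡
...       | refl = right (T⇒≤ {3} 3≤i) (T⇒≤ {i} i≤)

Vertex⇒isVertex : ∀ {k i j} → Vertex k i j → T (isVertex k i j)
Vertex⇒isVertex (inner 2≤i i≤j j≤k) = T-∨-injˡ (≤₃-T 2≤i i≤j j≤k)
Vertex⇒isVertex {k} {j = j} (lower 2≤j j≤) =
  T-∨-injʳ {2 ≤ᵇ suc j ∧ suc j ≤ᵇ j ∧ j ≤ᵇ k} (T-∨-injˡ
    (T-∧₃-intro (≡⇒T {suc j} refl) (≤⇒T (s≤s 2≤j)) (≤⇒T (subst (suc j ≤_) (ℕP.+-comm 2 k) (s≤s j≤)))))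
Vertex⇒isVertex {k} {i} (right 3≤i i≤) =
  T-∨-injʳ {2 ≤ᵇ i ∧ i ≤ᵇ suc k ∧ suc k ≤ᵇ k}
    (T-∨-injʳ {suc (suc k) ≡ᵇ i ∧ 3 ≤ᵇ i ∧ i ≤ᵇ (k +ℕ 2)}
    (T-∧₃-intro (≡⇒T {suc k} refl) (≤⇒T 3≤i) (≤⇒T i≤)))

¬Edge-vert : ∀ {k i j} → (2 ≤ i → i ≤ j → j ≤ k → ⊥) → (j ≡ suc k → 3 ≤ i → i ≤ suc k → ⊥) →
             ¬ Edge k vert i j
¬Edge-vert no-inner _ (inner _ 2≤i i≤j j≤k) = no-inner 2≤i i≤j j≤k
¬Edge-vert _ no-right (right 3≤i i≤) = no-right refl 3≤i i≤

¬Edge-diag : ∀ {k i j} → (2 ≤ i → i ≤ j → j ≤ k → ⊥) → (i ≡ suc j → 2 ≤ j → j ≤ k → ⊥) →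
             ¬ Edge k diag i j
¬Edge-diag no-inner _ (inner _ 2≤i i≤j j≤k) = no-inner 2≤i i≤j j≤k
¬Edge-diag _ no-lower (lower 2≤j j≤k) = no-lower refl 2≤j j≤k

val-edge : ∀ {k} f {t i j} → Edge k t i j → val k f t i j ≡ f (t , i , j)
val-edge f = if-true ∘ Edge⇒validE

val-nonEdge : ∀ {k} f {t i j} → ¬ Edge k t i j → val k f t i j ≡ 0ℚ
val-nonEdge f ¬e = if-false (¬e ∘ validE⇒Edge)

¬Edge-row1 : ∀ {k t j} → ¬ Edge k t 1 j
¬Edge-row1 (inner _ (s≤s ()) _ _)
¬Edge-row1 (right (s≤s ()) _)
¬Edge-row1 (lower () _)

¬Edge-vert-below : ∀ {k j} → j ≤ k → ¬ Edge k vert (suc j) j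
¬Edge-vert-below _ (inner _ _ sj≤j _) = ℕP.1+n≰n sj≤j
¬Edge-vert-below sk≤k (right _ _) = ℕP.1+n≰n sk≤k

netflow-top : ∀ k p {j} → 2 ≤ j → j ≤ k → netflow k p 2 j ≡ ℕ→ℚ (p (j ∸ 1)) - ℕ→ℚ (p j)
netflow-top k p {j} 2≤j j≤k =
  if-true {b = 2 ≡ᵇ 2 ∧ 2 ≤ᵇ j ∧ j ≤ᵇ k} (T-∧₃-intro tt (≤⇒T 2≤j) (≤⇒T j≤k))

netflow-zero : ∀ k p {i j} → 3 ≤ i → i ≤ suc k → netflow k p i j ≡ 0ℚ
netflow-zero k p {i} 3≤i i≤ =
  trans (if-false (¬T-∧ˡ {i ≡ᵇ 2} (≢⇒¬T≡ i≢2))) (if-false (¬T-∧ˡ {i ≡ᵇ (k +ℕ 2)} (≢⇒¬T≡ i≢k+2)))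
  where
  i≢2 : i ≢ 2
  i≢2 refl = ℕP.1+n≰n (s≤s⁻¹ 3≤i)
  i≢k+2 : i ≢ k +ℕ 2
  i≢k+2 refl = ℕP.1+n≰n (subst (_≤ suc k) (ℕP.+-comm k 2) i≤)

netflow-corner : ∀ k p → 1 ≤ k → netflow k p (suc (suc k)) (suc k) ≡ ℕ→ℚ (p k) - ℕ→ℚ (p 1)
netflow-corner (suc k) p _ =
  if-true {b = (suc (suc (suc k)) ≡ᵇ (suc k +ℕ 2)) ∧ (suc (suc k) ≡ᵇ suc (suc k))}
          (T-∧-intro (≡⇒T (ℕP.+-comm 2 (suc k))) (≡⇒T {suc (suc k)} refl))

Balanced : ℕ → (ℕ → ℕ) → (EIx → ℚ) → ℕ → ℕ → Set
Balanced k p f i j = inflow k f i j + netflow k p i j ≡ outflow k f i j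

-- Conservation at v_ij, once the flows on non-edges are dropped, is the equation L = R.
record Conservation (k : ℕ) (p : ℕ → ℕ) (f : EIx → ℚ) (i j : ℕ) (L R : ℚ) : Set where
  field
    in+net≡ : inflow k f i j + netflow k p i j ≡ L
    out≡    : outflow k f i j ≡ R

  to : Balanced k p f i j → L ≡ R
  to balanced = trans (sym in+net≡) (trans balanced out≡)

  from : L ≡ R → Balanced k p f i j
  from L≡R = trans in+net≡ (trans L≡R (sym out≡))

module _ {k : ℕ} (p : ℕ → ℕ) (f : EIx → ℚ) where

  private
    P : ℕ → ℚ
    P = ℕ→ℚ ∘ p
    edge : ∀ {t i j} → Edge k t i j → val k f t i j ≡ f (t , i , j)
    edge = val-edge f
    nonEdge : ∀ {t i j} → ¬ Edge k t i j → val k f t i j ≡ 0ℚ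
    nonEdge = val-nonEdge f

  conservation-top : ∀ {j} → 2 ≤ j → j ≤ k →
    Conservation k p f 2 j (P (j ∸ 1) - P j) (f (vert , 2 , j) + f (diag , 2 , j))
  conservation-top {j} 2≤j j≤k = record
    { in+net≡ = trans (cong₂ _+_ (cong₂ _+_ (nonEdge {vert} {1} {j} ¬Edge-row1) (nonEdge {diag} {1} {j ∸ 1} ¬Edge-row1))
                                 (netflow-top k p 2≤j j≤k))
                      (ℚP.+-identityˡ _)
    ; out≡ = cong₂ _+_ (edge (inner vert ℕP.≤-refl 2≤j j≤k)) (edge (inner diag ℕP.≤-refl 2≤j j≤k)) }

  conservation-inner : ∀ {i j} → 3 ≤ i → i ≤ j → j ≤ k →
    Conservation k p f i j (f (vert , i ∸ 1 , j) + f (diag , i ∸ 1 , j ∸ 1))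
                           (f (vert , i , j) + f (diag , i , j))
  conservation-inner 3≤i i≤j j≤k = record
    { in+net≡ = trans (cong₂ _+_ (cong₂ _+_ (edge (inner vert 2≤i-1 i-1≤j j≤k))
                                            (edge (inner diag 2≤i-1 (ℕP.∸-monoˡ-≤ 1 i≤j) j-1≤k)))
                                 (netflow-zero k p 3≤i (ℕP.m≤n⇒m≤1+n (ℕP.≤-trans i≤j j≤k))))
                      (ℚP.+-identityʳ _)
    ; out≡ = cong₂ _+_ (edge (inner vert 2≤i i≤j j≤k)) (edge (inner diag 2≤i i≤j j≤k)) }
    where
    2≤i = ℕP.≤-trans (ℕP.n≤1+n 2) 3≤i
    2≤i-1 = ℕP.∸-monoˡ-≤ 1 3≤i
    i-1≤j = ℕP.≤-trans (ℕP.m∸n≤m _ 1) i≤j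
    j-1≤k = ℕP.≤-trans (ℕP.m∸n≤m _ 1) j≤k

  conservation-lower : ∀ {j} → 1 ≤ j → suc j ≤ k →
    Conservation k p f (suc (suc j)) (suc j) (f (vert , suc j , suc j) + val k f diag (suc j) j)
                                             (f (diag , suc (suc j) , suc j))
  conservation-lower 1≤j sj≤k = record
    { in+net≡ = trans (cong₂ _+_ (cong (_+ val k f diag _ _) (edge (inner vert (s≤s 1≤j) ℕP.≤-refl sj≤k)))
                                 (netflow-zero k p (s≤s (s≤s 1≤j)) (s≤s sj≤k)))
                      (ℚP.+-identityʳ _)
    ; out≡ = trans (cong₂ _+_ (nonEdge (¬Edge-vert-below sj≤k)) (edge (lower (s≤s 1≤j) sj≤k))) (ℚP.+-identityˡ _) }

  conservation-corner : 1 ≤ k →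
    Conservation k p f (suc (suc k)) (suc k)
                 ((val k f vert (suc k) (suc k) + val k f diag (suc k) k) + (P k - P 1)) 0ℚ
  conservation-corner 1≤k = record
    { in+net≡ = cong (_+_ (val k f vert (suc k) (suc k) + val k f diag (suc k) k)) (netflow-corner k p 1≤k)
    ; out≡ = cong₂ _+_ (nonEdge (¬Edge-vert (λ _ i≤j _ → ℕP.1+n≰n i≤j) (λ _ _ i≤ → ℕP.1+n≰n i≤)))
                       (nonEdge (¬Edge-diag (λ _ i≤j _ → ℕP.1+n≰n i≤j) (λ _ _ j≤k → ℕP.1+n≰n j≤k))) }

  conservation-right : ∀ {i} → 1 ≤ i → suc i ≤ k →
    Conservation k p f (suc (suc i)) (suc k) (val k f vert (suc i) (suc k) + f (diag , suc i , k))
                                             (f (vert , suc (suc i) , suc k))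
  conservation-right {i} 1≤i si≤k = record
    { in+net≡ = trans (cong₂ _+_ (cong (_+_ (val k f vert (suc i) (suc k))) (edge (inner diag (s≤s 1≤i) si≤k ℕP.≤-refl)))
                                 (netflow-zero k p (s≤s (s≤s 1≤i)) (s≤s si≤k)))
                      (ℚP.+-identityʳ _)
    ; out≡ = trans (cong₂ _+_ (edge (right (s≤s (s≤s 1≤i)) (s≤s si≤k)))
                              (nonEdge {diag} {suc (suc i)} {suc k}
                                 (¬Edge-diag (λ _ _ sk≤k → ℕP.1+n≰n sk≤k)
                                             (λ eq _ _ → ℕP.1+n≰n (subst (_≤ k) (ℕP.suc-injective eq) si≤k)))))
                   (ℚP.+-identityʳ _) }

-- The edges v_21 → v_32 and v_2,k+1 → v_3,k+1 do not exist; the difference formulas give 0 there too.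
val-lower : ∀ {k} g (y : ℕ × ℕ → ℚ) {j} → 1 ≤ j → j ≤ k →
  (2 ≤ j → g (diag , suc j , j) ≡ y (1 , 1) - y (j , j)) →
  val k g diag (suc j) j ≡ y (1 , 1) - y (j , j)
val-lower {k} g y {suc zero} _ _ _ =
  trans (val-nonEdge {k} g {diag} {2} {1} (¬Edge-diag (λ { _ (s≤s ()) _ }) (λ { _ (s≤s ()) _ })))
        (sym (ℚP.+-inverseʳ (y (1 , 1))))
val-lower g y {suc (suc j)} _ j≤k eq = trans (val-edge g (lower (s≤s (s≤s z≤n)) j≤k)) (eq (s≤s (s≤s z≤n)))

val-right : ∀ {k} g (y : ℕ × ℕ → ℚ) {i} → 1 ≤ i → i ≤ k →
  (2 ≤ i → g (vert , suc i , suc k) ≡ y (i , k) - y (1 , k)) →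
  val k g vert (suc i) (suc k) ≡ y (i , k) - y (1 , k)
val-right {k} g y {suc zero} _ _ _ =
  trans (val-nonEdge {k} g {vert} {2} {suc k} (¬Edge-vert (λ _ _ sk≤k → ℕP.1+n≰n sk≤k) (λ { _ (s≤s (s≤s ())) _ })))
        (sym (ℚP.+-inverseʳ (y (1 , k))))
val-right g y {suc (suc i)} _ i≤k eq =
  trans (val-edge g (right (s≤s (s≤s (s≤s z≤n))) (s≤s i≤k))) (eq (s≤s (s≤s z≤n)))

-- From Gelfand–Tsetlin arrays to flows

-- The flow on an edge is a difference of two adjacent entries of the GT array:
-- v_ij → v_{i+1,j} carries y_{i-1,j-1} - y_ij and v_ij → v_{i+1,j+1} carries y_ij - y_{i-1,j};
-- the extra edges on column k+1 and below the diagonal compare with the corners y_1k and y_11.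
pos : ℕ → EIx → ℕ × ℕ
pos k (vert , i , j) = if j ≡ᵇ suc k then (i ∸ 1 , k) else (i ∸ 1 , j ∸ 1)
pos k (diag , i , j) = if suc j ≡ᵇ i then (1 , 1) else (i , j)

neg : ℕ → EIx → ℕ × ℕ
neg k (vert , i , j) = if j ≡ᵇ suc k then (1 , k) else (i , j)
neg k (diag , i , j) = if suc j ≡ᵇ i then (i ∸ 1 , i ∸ 1) else (i ∸ 1 , j)

toFlow : ℕ → (ℕ × ℕ → ℚ) → EIx → ℚ
toFlow k y e = y (pos k e) - y (neg k e)

toFlow-vert : ∀ k y {i j} → j ≤ k → toFlow k y (vert , i , j) ≡ y (i ∸ 1 , j ∸ 1) - y (i , j)
toFlow-vert k y j≤k = cong₂ _-_ (cong y (if-false j≢)) (cong y (if-false j≢))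
  where j≢ = ≢⇒¬T≡ (≤⇒≢1+ j≤k)

toFlow-right : ∀ k y i → toFlow k y (vert , i , suc k) ≡ y (i ∸ 1 , k) - y (1 , k)
toFlow-right k y i = cong₂ _-_ (cong y (if-true (≡⇒T {suc k} refl))) (cong y (if-true (≡⇒T {suc k} refl)))

toFlow-diag : ∀ k y {i j} → i ≤ j → toFlow k y (diag , i , j) ≡ y (i , j) - y (i ∸ 1 , j)
toFlow-diag k y i≤j = cong₂ _-_ (cong y (if-false i≢)) (cong y (if-false i≢))
  where i≢ = ≢⇒¬T≡ (≤⇒≢1+ i≤j ∘ sym)

toFlow-lower : ∀ k y j → toFlow k y (diag , suc j , j) ≡ y (1 , 1) - y (j , j)
toFlow-lower k y j = cong₂ _-_ (cong y (if-true (≡⇒T {suc j} refl))) (cong y (if-true (≡⇒T {suc j} refl)))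

pos-neg∈triangle : ∀ {k t i j} → Edge k t i j →
                   InTriangle k (pos k (t , i , j)) × InTriangle k (neg k (t , i , j))
pos-neg∈triangle {k} (inner vert 2≤i i≤j j≤k) =
    subst (InTriangle k) (sym (if-false j≢))
      (ℕP.∸-monoˡ-≤ 1 2≤i , ℕP.∸-monoˡ-≤ 1 i≤j , ℕP.≤-trans (ℕP.m∸n≤m _ 1) j≤k)
  , subst (InTriangle k) (sym (if-false j≢)) (ℕP.≤-trans (s≤s z≤n) 2≤i , i≤j , j≤k)
  where j≢ = ≢⇒¬T≡ (≤⇒≢1+ j≤k)
pos-neg∈triangle {k} (inner diag 2≤i i≤j j≤k) =
    subst (InTriangle k) (sym (if-false i≢)) (ℕP.≤-trans (s≤s z≤n) 2≤i , i≤j , j≤k)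
  , subst (InTriangle k) (sym (if-false i≢))
      (ℕP.∸-monoˡ-≤ 1 2≤i , ℕP.≤-trans (ℕP.m∸n≤m _ 1) i≤j , j≤k)
  where i≢ = ≢⇒¬T≡ (≤⇒≢1+ i≤j ∘ sym)
pos-neg∈triangle {k} {i = suc i} (right (s≤s 2≤i) i≤) =
    subst (InTriangle k) (sym (if-true (≡⇒T {suc k} refl))) (ℕP.≤-trans (s≤s z≤n) 2≤i , s≤s⁻¹ i≤ , ℕP.≤-refl)
  , subst (InTriangle k) (sym (if-true (≡⇒T {suc k} refl))) (s≤s z≤n , 1≤k , ℕP.≤-refl)
  where 1≤k = ℕP.≤-trans (ℕP.≤-trans (s≤s z≤n) 2≤i) (s≤s⁻¹ i≤)
pos-neg∈triangle {k} {j = j} (lower 2≤j j≤k) =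
    subst (InTriangle k) (sym (if-true (≡⇒T {suc j} refl))) (s≤s z≤n , s≤s z≤n , ℕP.≤-trans 1≤j j≤k)
  , subst (InTriangle k) (sym (if-true (≡⇒T {suc j} refl))) (1≤j , ℕP.≤-refl , j≤k)
  where 1≤j = ℕP.≤-trans (s≤s z≤n) 2≤j

module _ {k : ℕ} {p : ℕ → ℕ} {y : ℕ × ℕ → ℚ} (gt : GT k p y) where

  private
    top-row = proj₁ (proj₂ gt)
    interlace = proj₂ (proj₂ gt)
    ψ = toFlow k y
    P = ℕ→ℚ ∘ p
    open ≡-Reasoning

  y₁ₖ≤yₘₖ : ∀ m → 1 ≤ m → m ≤ k → y (1 , k) ≤ℚ y (m , k)
  y₁ₖ≤yₘₖ (suc zero) _ _ = ℚP.≤-refl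
  y₁ₖ≤yₘₖ (suc (suc m)) _ m≤k =
    ℚP.≤-trans (y₁ₖ≤yₘₖ (suc m) (s≤s z≤n) (ℕP.≤-trans (ℕP.n≤1+n _) m≤k))
               (proj₂ (interlace (suc (suc m)) k (s≤s (s≤s z≤n)) m≤k ℕP.≤-refl))

  yₘₘ≤y₁₁ : ∀ m → 1 ≤ m → m ≤ k → y (m , m) ≤ℚ y (1 , 1)
  yₘₘ≤y₁₁ (suc zero) _ _ = ℚP.≤-refl
  yₘₘ≤y₁₁ (suc (suc m)) _ m≤k =
    ℚP.≤-trans (proj₁ (interlace (suc (suc m)) (suc (suc m)) (s≤s (s≤s z≤n)) ℕP.≤-refl m≤k))
               (yₘₘ≤y₁₁ (suc m) (s≤s z≤n) (ℕP.≤-trans (ℕP.n≤1+n _) m≤k))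

  toFlow-nonneg : ∀ {t i j} → Edge k t i j → 0ℚ ≤ℚ toFlow k y (t , i , j)
  toFlow-nonneg (inner vert 2≤i i≤j j≤k) =
    subst (0ℚ ≤ℚ_) (sym (toFlow-vert k y j≤k)) (0≤p-q (proj₁ (interlace _ _ 2≤i i≤j j≤k)))
  toFlow-nonneg (inner diag 2≤i i≤j j≤k) =
    subst (0ℚ ≤ℚ_) (sym (toFlow-diag k y i≤j)) (0≤p-q (proj₂ (interlace _ _ 2≤i i≤j j≤k)))
  toFlow-nonneg {i = i} (right 3≤i i≤) =
    subst (0ℚ ≤ℚ_) (sym (toFlow-right k y i))
      (0≤p-q (y₁ₖ≤yₘₖ (i ∸ 1) (ℕP.∸-monoˡ-≤ 1 (ℕP.≤-trans (ℕP.n≤1+n 2) 3≤i))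
                             (ℕP.∸-monoˡ-≤ 1 i≤)))
  toFlow-nonneg {j = j} (lower 2≤j j≤k) =
    subst (0ℚ ≤ℚ_) (sym (toFlow-lower k y j)) (0≤p-q (yₘₘ≤y₁₁ j (ℕP.≤-trans (s≤s z≤n) 2≤j) j≤k))

  toFlow-balanced-top : ∀ {j} → 2 ≤ j → j ≤ k → Balanced k p ψ 2 j
  toFlow-balanced-top {j} 2≤j j≤k = Conservation.from (conservation-top p ψ 2≤j j≤k) (begin
    P (j ∸ 1) - P j
      ≡⟨ cong₂ _-_ (sym (top-row (j ∸ 1) (ℕP.∸-monoˡ-≤ 1 2≤j) (ℕP.≤-trans (ℕP.m∸n≤m j 1) j≤k)))
                   (sym (top-row j (ℕP.≤-trans (s≤s z≤n) 2≤j) j≤k)) ⟩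
    y (1 , j ∸ 1) - y (1 , j)
      ≡⟨ solve 3 (λ a b c → a :- c := (a :- b) :+ (b :- c)) refl (y (1 , j ∸ 1)) (y (2 , j)) (y (1 , j)) ⟩
    (y (1 , j ∸ 1) - y (2 , j)) + (y (2 , j) - y (1 , j))
      ≡⟨ sym (cong₂ _+_ (toFlow-vert k y j≤k) (toFlow-diag k y 2≤j)) ⟩
    ψ (vert , 2 , j) + ψ (diag , 2 , j) ∎)

  toFlow-balanced-inner : ∀ {i j} → 3 ≤ i → i ≤ j → j ≤ k → Balanced k p ψ i j
  toFlow-balanced-inner {i} {j} 3≤i i≤j j≤k = Conservation.from (conservation-inner p ψ 3≤i i≤j j≤k) (begin
    ψ (vert , i ∸ 1 , j) + ψ (diag , i ∸ 1 , j ∸ 1)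
      ≡⟨ cong₂ _+_ (toFlow-vert k y j≤k) (toFlow-diag k y (ℕP.∸-monoˡ-≤ 1 i≤j)) ⟩
    (y (i ∸ 1 ∸ 1 , j ∸ 1) - y (i ∸ 1 , j)) + (y (i ∸ 1 , j ∸ 1) - y (i ∸ 1 ∸ 1 , j ∸ 1))
      ≡⟨ solve 4 (λ a b c d → (a :- b) :+ (c :- a) := (c :- d) :+ (d :- b)) refl
               (y (i ∸ 1 ∸ 1 , j ∸ 1)) (y (i ∸ 1 , j)) (y (i ∸ 1 , j ∸ 1)) (y (i , j)) ⟩
    (y (i ∸ 1 , j ∸ 1) - y (i , j)) + (y (i , j) - y (i ∸ 1 , j))
      ≡⟨ sym (cong₂ _+_ (toFlow-vert k y j≤k) (toFlow-diag k y i≤j)) ⟩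
    ψ (vert , i , j) + ψ (diag , i , j) ∎)

  toFlow-balanced-lower : ∀ {j} → 1 ≤ j → suc j ≤ k → Balanced k p ψ (suc (suc j)) (suc j)
  toFlow-balanced-lower {j} 1≤j sj≤k = Conservation.from (conservation-lower p ψ 1≤j sj≤k) (begin
    ψ (vert , suc j , suc j) + val k ψ diag (suc j) j
      ≡⟨ cong₂ _+_ (toFlow-vert k y sj≤k)
                   (val-lower ψ y 1≤j (ℕP.≤-trans (ℕP.n≤1+n j) sj≤k) (λ _ → toFlow-lower k y j)) ⟩
    (y (j , j) - y (suc j , suc j)) + (y (1 , 1) - y (j , j))
      ≡⟨ solve 3 (λ a b c → (a :- b) :+ (c :- a) := c :- b) refl (y (j , j)) (y (suc j , suc j)) (y (1 , 1)) ⟩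
    y (1 , 1) - y (suc j , suc j)
      ≡⟨ sym (toFlow-lower k y (suc j)) ⟩
    ψ (diag , suc (suc j) , suc j) ∎)

  toFlow-balanced-corner : 1 ≤ k → Balanced k p ψ (suc (suc k)) (suc k)
  toFlow-balanced-corner 1≤k = Conservation.from (conservation-corner p ψ 1≤k) (begin
    (val k ψ vert (suc k) (suc k) + val k ψ diag (suc k) k) + (P k - P 1)
      ≡⟨ cong₂ _+_ (cong₂ _+_ (val-right ψ y 1≤k ℕP.≤-refl (λ _ → toFlow-right k y (suc k)))
                              (val-lower ψ y 1≤k ℕP.≤-refl (λ _ → toFlow-lower k y k)))
                   (cong₂ _-_ (sym (top-row k 1≤k ℕP.≤-refl)) (sym (top-row 1 ℕP.≤-refl 1≤k))) ⟩
    ((y (k , k) - y (1 , k)) + (y (1 , 1) - y (k , k))) + (y (1 , k) - y (1 , 1))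
      ≡⟨ solve 3 (λ a b c → ((a :- b) :+ (c :- a)) :+ (b :- c) := con 0ℚ) refl (y (k , k)) (y (1 , k)) (y (1 , 1)) ⟩
    0ℚ ∎)

  toFlow-balanced-right : ∀ {i} → 1 ≤ i → suc i ≤ k → Balanced k p ψ (suc (suc i)) (suc k)
  toFlow-balanced-right {i} 1≤i si≤k = Conservation.from (conservation-right p ψ 1≤i si≤k) (begin
    val k ψ vert (suc i) (suc k) + ψ (diag , suc i , k)
      ≡⟨ cong₂ _+_ (val-right ψ y 1≤i (ℕP.≤-trans (ℕP.n≤1+n i) si≤k) (λ _ → toFlow-right k y (suc i)))
                   (toFlow-diag k y si≤k) ⟩
    (y (i , k) - y (1 , k)) + (y (suc i , k) - y (i , k))
      ≡⟨ solve 3 (λ a b c → (a :- b) :+ (c :- a) := c :- b) refl (y (i , k)) (y (1 , k)) (y (suc i , k)) ⟩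
    y (suc i , k) - y (1 , k)
      ≡⟨ sym (toFlow-right k y (suc (suc i))) ⟩
    ψ (vert , suc (suc i) , suc k) ∎)

  toFlow-balanced : ∀ {i j} → Vertex k i j → Balanced k p ψ i j
  toFlow-balanced (inner {suc zero} (s≤s ()) _ _)
  toFlow-balanced (inner {suc (suc zero)} _ 2≤j j≤k) = toFlow-balanced-top 2≤j j≤k
  toFlow-balanced (inner {suc (suc (suc _))} _ i≤j j≤k) = toFlow-balanced-inner (s≤s (s≤s (s≤s z≤n))) i≤j j≤k
  toFlow-balanced (lower {suc zero} (s≤s ()) _)
  toFlow-balanced (lower {suc j} (s≤s 1≤j) sj≤) with ℕP.m≤n⇒m<n∨m≡n sj≤
  ... | inj₁ sj<sk = toFlow-balanced-lower 1≤j (s≤s⁻¹ sj<sk)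
  ... | inj₂ refl = toFlow-balanced-corner 1≤j
  toFlow-balanced (right {suc zero} (s≤s ()) _)
  toFlow-balanced (right {suc (suc i)} (s≤s (s≤s 1≤i)) ssi≤) = toFlow-balanced-right 1≤i (s≤s⁻¹ ssi≤)

  toFlow-flow : Flow k p (toFlow k y)
  toFlow-flow = (λ t i j → toFlow-nonneg {t} {i} {j} ∘ validE⇒Edge) , (λ i j → toFlow-balanced {i} {j} ∘ isVertex⇒Vertex)

-- From flows to Gelfand–Tsetlin arrays

toGT : (ℕ → ℕ) → (EIx → ℚ) → ℕ × ℕ → ℚ
toGT p f (zero , j) = 0ℚ
toGT p f (suc zero , j) = ℕ→ℚ (p j)
toGT p f (suc (suc i) , j) = toGT p f (suc i , j) + f (diag , suc (suc i) , j)

module _ {k : ℕ} {p : ℕ → ℕ} {f : EIx → ℚ} (flow : Flow k p f) where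

  private
    y = toGT p f
    nonneg = proj₁ flow
    balanced : ∀ {i j} → Vertex k i j → Balanced k p f i j
    balanced {i} {j} = proj₂ flow i j ∘ Vertex⇒isVertex
    open ≡-Reasoning

  flow-vert : ∀ {i j} → 2 ≤ i → i ≤ j → j ≤ k → f (vert , i , j) ≡ y (i ∸ 1 , j ∸ 1) - y (i , j)
  flow-vert {suc zero} (s≤s ()) _ _
  flow-vert {suc (suc zero)} {j} _ 2≤j j≤k = begin
    f (vert , 2 , j)
      ≡⟨ p≡q+r⇒q≡p-r (Conservation.to (conservation-top p f 2≤j j≤k) (balanced (inner ℕP.≤-refl 2≤j j≤k))) ⟩
    (y (1 , j ∸ 1) - y (1 , j)) - f (diag , 2 , j)
      ≡⟨ solve 3 (λ a b c → (a :- b) :- c := a :- (b :+ c)) refl (y (1 , j ∸ 1)) (y (1 , j)) (f (diag , 2 , j)) ⟩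
    y (1 , j ∸ 1) - y (2 , j) ∎
  flow-vert {i@(suc (suc (suc a)))} {j} 2≤i i≤j j≤k = begin
    f (vert , i , j)
      ≡⟨ p≡q+r⇒q≡p-r (Conservation.to (conservation-inner p f (s≤s (s≤s (s≤s z≤n))) i≤j j≤k)
                                      (balanced (inner 2≤i i≤j j≤k))) ⟩
    (f (vert , i ∸ 1 , j) + f (diag , i ∸ 1 , j ∸ 1)) - f (diag , i , j)
      ≡⟨ cong (λ v → (v + f (diag , i ∸ 1 , j ∸ 1)) - f (diag , i , j))
              (flow-vert {suc (suc a)} {j} (s≤s (s≤s z≤n)) (ℕP.≤-trans (ℕP.n≤1+n _) i≤j) j≤k) ⟩
    ((y (suc a , j ∸ 1) - y (i ∸ 1 , j)) + f (diag , i ∸ 1 , j ∸ 1)) - f (diag , i , j)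
      ≡⟨ solve 4 (λ a b c d → ((a :- b) :+ c) :- d := (a :+ c) :- (b :+ d)) refl
               (y (suc a , j ∸ 1)) (y (i ∸ 1 , j)) (f (diag , i ∸ 1 , j ∸ 1)) (f (diag , i , j)) ⟩
    y (i ∸ 1 , j ∸ 1) - y (i , j) ∎

  flow-right : ∀ {i} → 1 ≤ i → suc i ≤ k → f (vert , suc (suc i) , suc k) ≡ y (suc i , k) - y (1 , k)
  flow-right {suc i} 1≤i si≤k = begin
    f (vert , suc (suc (suc i)) , suc k)
      ≡⟨ sym (Conservation.to (conservation-right p f 1≤i si≤k) (balanced (right (s≤s (s≤s 1≤i)) (s≤s si≤k)))) ⟩
    val k f vert (suc (suc i)) (suc k) + f (diag , suc (suc i) , k)
      ≡⟨ cong (_+ f (diag , suc (suc i) , k)) (val-right f y 1≤i (ℕP.≤-trans (ℕP.n≤1+n _) si≤k) previous) ⟩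
    (y (suc i , k) - y (1 , k)) + f (diag , suc (suc i) , k)
      ≡⟨ solve 3 (λ a b d → (a :- b) :+ d := (a :+ d) :- b) refl (y (suc i , k)) (y (1 , k)) (f (diag , suc (suc i) , k)) ⟩
    y (suc (suc i) , k) - y (1 , k) ∎
    where
    previous : 2 ≤ suc i → f (vert , suc (suc i) , suc k) ≡ y (suc i , k) - y (1 , k)
    previous (s≤s 1≤i′) = flow-right {i} 1≤i′ (ℕP.≤-trans (ℕP.n≤1+n _) si≤k)

  flow-lower : ∀ {j} → 1 ≤ j → suc j ≤ k → f (diag , suc (suc j) , suc j) ≡ y (1 , 1) - y (suc j , suc j)
  flow-lower {j@(suc j′)} 1≤j sj≤k = begin
    f (diag , suc (suc j) , suc j)
      ≡⟨ sym (Conservation.to (conservation-lower p f 1≤j sj≤k)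
                              (balanced (lower (s≤s 1≤j) (ℕP.m≤n⇒m≤1+n sj≤k)))) ⟩
    f (vert , suc j , suc j) + val k f diag (suc j) j
      ≡⟨ cong₂ _+_ (flow-vert (s≤s 1≤j) ℕP.≤-refl sj≤k)
                   (val-lower f y 1≤j (ℕP.≤-trans (ℕP.n≤1+n _) sj≤k) previous) ⟩
    (y (j , j) - y (suc j , suc j)) + (y (1 , 1) - y (j , j))
      ≡⟨ solve 3 (λ a b c → (a :- b) :+ (c :- a) := c :- b) refl (y (j , j)) (y (suc j , suc j)) (y (1 , 1)) ⟩
    y (1 , 1) - y (suc j , suc j) ∎
    where
    previous : 2 ≤ j → f (diag , suc j , j) ≡ y (1 , 1) - y (j , j)
    previous (s≤s 1≤j′) = flow-lower {j′} 1≤j′ (ℕP.≤-trans (ℕP.n≤1+n _) sj≤k)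

  toFlow-toGT : ∀ {t i j} → Edge k t i j → toFlow k y (t , i , j) ≡ f (t , i , j)
  toFlow-toGT (inner vert 2≤i i≤j j≤k) = trans (toFlow-vert k y j≤k) (sym (flow-vert 2≤i i≤j j≤k))
  toFlow-toGT {i = suc zero} (inner diag (s≤s ()) _ _)
  toFlow-toGT {i = suc (suc i)} {j} (inner diag _ i≤j _) =
    trans (toFlow-diag k y i≤j) (solve 2 (λ a d → (a :+ d) :- a := d) refl (y (suc i , j)) (f (diag , suc (suc i) , j)))
  toFlow-toGT (right {suc (suc i)} (s≤s (s≤s 1≤i)) ssi≤) =
    trans (toFlow-right k y (suc (suc i))) (sym (flow-right 1≤i (s≤s⁻¹ ssi≤)))
  toFlow-toGT (lower {suc j} (s≤s 1≤j) sj≤k) = trans (toFlow-lower k y (suc j)) (sym (flow-lower 1≤j sj≤k))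

  toGT-GT : GT k p y
  toGT-GT = y-nonneg , (λ _ _ _ → refl) , interlace
    where
    y-nonneg : ∀ i j → 1 ≤ i → i ≤ j → j ≤ k → 0ℚ ≤ℚ y (i , j)
    y-nonneg (suc zero) j _ _ _ = 0≤ℕ→ℚ (p j)
    y-nonneg (suc (suc i)) j _ i≤j j≤k =
      ℚP.≤-trans (y-nonneg (suc i) j (s≤s z≤n) (ℕP.≤-trans (ℕP.n≤1+n _) i≤j) j≤k)
                 (p≤p+q (nonneg diag (suc (suc i)) j (Edge⇒validE (inner diag (s≤s (s≤s z≤n)) i≤j j≤k))))
    interlace : ∀ i j → 2 ≤ i → i ≤ j → j ≤ k →
                (y (i , j) ≤ℚ y (i ∸ 1 , j ∸ 1)) × (y (i ∸ 1 , j) ≤ℚ y (i , j))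
    interlace (suc zero) _ (s≤s ()) _ _
    interlace (suc (suc i)) j 2≤i i≤j j≤k =
        0≤p-q⇒q≤p (subst (0ℚ ≤ℚ_) (flow-vert 2≤i i≤j j≤k)
                         (nonneg vert _ _ (Edge⇒validE (inner vert 2≤i i≤j j≤k))))
      , p≤p+q (nonneg diag _ _ (Edge⇒validE (inner diag 2≤i i≤j j≤k)))

-- An edge of G_n whose two entries straddle the boundary of the shifted triangle of λ^(k)
-- reads 0 in place of the corner entry y_11 = λ_1 (diagonal edges) or y_1k = λ_k (column n+1);
-- the offset puts that value back.
offset : ℕ → (ℕ → ℕ → ℕ) → ℕ → EIx → ℕ
offset n lam k (vert , i , j) = if j ≡ᵇ suc n then (if (k +ℕ 2) ≤ᵇ i then lam k k else 0) else 0
offset n lam k (diag , i , j) = if suc j ≡ᵇ i then 0 else (if ((n ∸ k) +ℕ i) ≡ᵇ suc j then lam k 1 else 0)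

translation : ℕ → (ℕ → ℕ → ℕ) → EIx → ℚ
translation n lam e = sumℚ (map (λ k → ℕ→ℚ (offset n lam k e)) (between 1 n))

gtFlowMap : (n : ℕ) → (ℕ → ℕ → ℕ) → Affine (GTSp n) (FSp n)
gtFlowMap n lam = record { A = λ e s → δ (pos n e) s - δ (neg n e) s ; b = translation n lam }

apply-gtFlowMap : ∀ n lam x {t i j} → Edge n t i j →
  apply (gtFlowMap n lam) x (t , i , j) ≡ translation n lam (t , i , j) + toFlow n x (t , i , j)
apply-gtFlowMap n lam x {t} {i} {j} e = cong (_+_ (translation n lam (t , i , j))) (begin
  sumℚ (map (λ s → (δ p s - δ q s) * x s) (coords (GTSp n)))
    ≡⟨ sumℚ-cong (coords (GTSp n))
                 (λ s _ → solve 3 (λ a b c → (a :- b) :* c := a :* c :- b :* c) refl (δ p s) (δ q s) (x s)) ⟩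
  sumℚ (map (λ s → δ p s * x s - δ q s * x s) (coords (GTSp n)))
    ≡⟨ sumℚ-minus (coords (GTSp n)) (λ s → δ p s * x s) (λ s → δ q s * x s) ⟩
  sumℚ (map (λ s → δ p s * x s) (coords (GTSp n))) - sumℚ (map (λ s → δ q s * x s) (coords (GTSp n)))
    ≡⟨ cong₂ _-_ (sumℚ-δ n x (proj₁ (pos-neg∈triangle e))) (sumℚ-δ n x (proj₂ (pos-neg∈triangle e))) ⟩
  x p - x q ∎)
  where
  open ≡-Reasoning
  p = pos n (t , i , j)
  q = neg n (t , i , j)

module _ (n k : ℕ) where

  private
    d = n ∸ k

  embGT-inside : ∀ y {a b} → d +ℕ a ≤ b → embGT n k y (a , b) ≡ y (a , b ∸ d)
  embGT-inside y = if-true ∘ ≤⇒T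

  embGT-outside : ∀ y {a b} → b < d +ℕ a → embGT n k y (a , b) ≡ 0ℚ
  embGT-outside y = if-false ∘ >⇒¬T≤

  embF-inside : ∀ F {t i j} → d ≤ j → embF n k F (t , i , j) ≡ val k F t i (j ∸ d)
  embF-inside F = if-true ∘ ≤⇒T

  embF-nonEdge : ∀ F {t i j} → (d ≤ j → ¬ Edge k t i (j ∸ d)) → embF n k F (t , i , j) ≡ 0ℚ
  embF-nonEdge F {j = j} ¬edge with d ℕP.≤? j
  ... | yes d≤j = trans (embF-inside F d≤j) (val-nonEdge F (¬edge d≤j))
  ... | no d≰j = if-false (>⇒¬T≤ (ℕP.≰⇒> d≰j))

module _ {n k : ℕ} (lam : ℕ → ℕ → ℕ) (1≤k : 1 ≤ k) (k≤n : k ≤ n)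
         {y : ℕ × ℕ → ℚ} (gt : GT k (lam k) y) where

  private
    d = n ∸ k
    X = embGT n k y
    ψ = toFlow k y
    d+k≡n : d +ℕ k ≡ n
    d+k≡n = ℕP.m∸n+n≡m k≤n
    top-row = proj₁ (proj₂ gt)
    open ≡-Reasoning

  toFlow-embGT-vert : ∀ {i j} → 2 ≤ i → i ≤ j → j ≤ n →
    toFlow n X (vert , i , j) + ℕ→ℚ (offset n lam k (vert , i , j)) ≡ embF n k ψ (vert , i , j)
  toFlow-embGT-vert {i} {j} 2≤i i≤j j≤n =
    trans (cong₂ _+_ (toFlow-vert n X j≤n) (cong ℕ→ℚ (if-false (≢⇒¬T≡ (≤⇒≢1+ j≤n)))))
          (trans (ℚP.+-identityʳ _) (by-position (d +ℕ i ℕP.≤? j)))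
    where
    1≤i = ℕP.≤-trans (ℕP.n≤1+n 1) 2≤i
    j-d≤k = ℕP.m≤n+o⇒m∸n≤o j d (subst (j ≤_) (sym d+k≡n) j≤n)
    by-position : Dec (d +ℕ i ≤ j) → X (i ∸ 1 , j ∸ 1) - X (i , j) ≡ embF n k ψ (vert , i , j)
    by-position (yes inside) = begin
      X (i ∸ 1 , j ∸ 1) - X (i , j)
        ≡⟨ cong₂ _-_ (trans (embGT-inside n k y (subst (_≤ j ∸ 1) (ℕP.+-∸-assoc d 1≤i) (ℕP.∸-monoˡ-≤ 1 inside)))
                            (cong (λ m → y (i ∸ 1 , m)) (∸-∸-comm j 1 d)))
                     (embGT-inside n k y inside) ⟩
      y (i ∸ 1 , (j ∸ d) ∸ 1) - y (i , j ∸ d)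
        ≡⟨ sym (toFlow-vert k y j-d≤k) ⟩
      ψ (vert , i , j ∸ d)
        ≡⟨ sym (trans (embF-inside n k ψ {vert} {i} {j} (ℕP.m+n≤o⇒m≤o d inside))
                      (val-edge ψ (inner vert 2≤i (m+n≤o⇒n≤o∸m d inside) j-d≤k))) ⟩
      embF n k ψ (vert , i , j) ∎
    by-position (no outside) = begin
      X (i ∸ 1 , j ∸ 1) - X (i , j)
        ≡⟨ cong₂ _-_ (embGT-outside n k y (subst (j ∸ 1 <_) (ℕP.+-∸-assoc d 1≤i)
                                                 (ℕP.∸-monoˡ-< (ℕP.≰⇒> outside) (ℕP.≤-trans 1≤i i≤j))))
                     (embGT-outside n k y (ℕP.≰⇒> outside)) ⟩
      0ℚ - 0ℚ
        ≡⟨ sym (embF-nonEdge n k ψ {vert} {i} {j}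
                 (λ d≤j → ¬Edge-vert (λ _ i≤ _ → outside (n≤o∸m⇒m+n≤o d≤j i≤))
                                                       (λ eq _ _ → ≤⇒≢1+ j-d≤k eq))) ⟩
      embF n k ψ (vert , i , j) ∎

  toFlow-embGT-diag : ∀ {i j} → 2 ≤ i → i ≤ j → j ≤ n →
    toFlow n X (diag , i , j) + ℕ→ℚ (offset n lam k (diag , i , j)) ≡ embF n k ψ (diag , i , j)
  toFlow-embGT-diag {i@(suc i′)} {j} 2≤i i≤j j≤n =
    trans (cong₂ _+_ (toFlow-diag n X i≤j) (cong ℕ→ℚ (if-false (≢⇒¬T≡ (≤⇒≢1+ i≤j ∘ sym)))))
          (by-position (ℕP.<-cmp (d +ℕ i) (suc j)))
    where
    1≤i′ = s≤s⁻¹ 2≤i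
    j-d≤k = ℕP.m≤n+o⇒m∸n≤o j d (subst (j ≤_) (sym d+k≡n) j≤n)
    C = ℕ→ℚ (if (d +ℕ i) ≡ᵇ suc j then lam k 1 else 0)
    d+i′<d+i : d +ℕ i′ < d +ℕ i
    d+i′<d+i = ℕP.+-monoʳ-< d ℕP.≤-refl
    by-position : Tri (d +ℕ i < suc j) (d +ℕ i ≡ suc j) (suc j < d +ℕ i) →
                  (X (i , j) - X (i′ , j)) + C ≡ embF n k ψ (diag , i , j)
    by-position (tri< d+i<1+j _ _) = begin
      (X (i , j) - X (i′ , j)) + C
        ≡⟨ cong₂ _+_ (cong₂ _-_ (embGT-inside n k y inside)
                                (embGT-inside n k y (ℕP.≤-trans (ℕP.<⇒≤ d+i′<d+i) inside)))
                     (cong ℕ→ℚ (if-false (≢⇒¬T≡ (ℕP.<⇒≢ d+i<1+j)))) ⟩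
      (y (i , j ∸ d) - y (i′ , j ∸ d)) + 0ℚ
        ≡⟨ ℚP.+-identityʳ _ ⟩
      y (i , j ∸ d) - y (i′ , j ∸ d)
        ≡⟨ sym (toFlow-diag k y (m+n≤o⇒n≤o∸m d inside)) ⟩
      ψ (diag , i , j ∸ d)
        ≡⟨ sym (trans (embF-inside n k ψ {diag} {i} {j} (ℕP.m+n≤o⇒m≤o d inside))
                      (val-edge ψ (inner diag 2≤i (m+n≤o⇒n≤o∸m d inside) j-d≤k))) ⟩
      embF n k ψ (diag , i , j) ∎
      where inside = s≤s⁻¹ d+i<1+j
    by-position (tri≈ _ d+i≡1+j _) = begin
      (X (i , j) - X (i′ , j)) + C
        ≡⟨ cong₂ _+_ (cong₂ _-_ (embGT-outside n k y (subst (j <_) (sym d+i≡1+j) ℕP.≤-refl))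
                                (embGT-inside n k y (ℕP.≤-reflexive d+i′≡j)))
                     (cong ℕ→ℚ (if-true (≡⇒T d+i≡1+j))) ⟩
      (0ℚ - y (i′ , j ∸ d)) + ℕ→ℚ (lam k 1)
        ≡⟨ cong₂ (λ m z → (0ℚ - y (i′ , m)) + z) j-d≡i′ (sym (top-row 1 ℕP.≤-refl 1≤k)) ⟩
      (0ℚ - y (i′ , i′)) + y (1 , 1)
        ≡⟨ solve 2 (λ a b → (con 0ℚ :- a) :+ b := b :- a) refl (y (i′ , i′)) (y (1 , 1)) ⟩
      y (1 , 1) - y (i′ , i′)
        ≡⟨ sym (val-lower ψ y 1≤i′ (subst (_≤ k) j-d≡i′ j-d≤k) (λ _ → toFlow-lower k y i′)) ⟩
      val k ψ diag i i′
        ≡⟨ sym (trans (embF-inside n k ψ {diag} {i} {j} (subst (d ≤_) d+i′≡j (ℕP.m≤m+n d i′)))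
                      (cong (val k ψ diag i) j-d≡i′)) ⟩
      embF n k ψ (diag , i , j) ∎
      where
      d+i′≡j : d +ℕ i′ ≡ j
      d+i′≡j = ℕP.suc-injective (trans (sym (ℕP.+-suc d i′)) d+i≡1+j)
      j-d≡i′ : j ∸ d ≡ i′
      j-d≡i′ = trans (cong (_∸ d) (sym d+i′≡j)) (ℕP.m+n∸m≡n d i′)
    by-position (tri> _ _ 1+j<d+i) = begin
      (X (i , j) - X (i′ , j)) + C
        ≡⟨ cong₂ _+_ (cong₂ _-_ (embGT-outside n k y (ℕP.<-trans (ℕP.n<1+n j) 1+j<d+i))
                                (embGT-outside n k y (s≤s⁻¹ (subst (suc j <_) (ℕP.+-suc d i′) 1+j<d+i))))
                     (cong ℕ→ℚ (if-false (≢⇒¬T≡ (ℕP.>⇒≢ 1+j<d+i)))) ⟩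
      (0ℚ - 0ℚ) + 0ℚ
        ≡⟨ sym (embF-nonEdge n k ψ {diag} {i} {j} (λ d≤j → ¬Edge-diag
              (λ _ i≤j-d _ → ℕP.<⇒≱ (ℕP.<-trans (ℕP.n<1+n j) 1+j<d+i) (n≤o∸m⇒m+n≤o d≤j i≤j-d))
              (λ i≡ _ _ → ℕP.<⇒≢ 1+j<d+i
                 (sym (trans (cong (d +ℕ_) i≡) (trans (ℕP.+-suc d _) (cong suc (ℕP.m+[n∸m]≡n d≤j)))))))) ⟩
      embF n k ψ (diag , i , j) ∎

  toFlow-embGT-right : ∀ {i} → 3 ≤ i →
    toFlow n X (vert , i , suc n) + ℕ→ℚ (offset n lam k (vert , i , suc n)) ≡ embF n k ψ (vert , i , suc n)
  toFlow-embGT-right {i@(suc i′)} 3≤i =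
    trans (cong₂ _+_ (toFlow-right n X i) (cong ℕ→ℚ (if-true (≡⇒T {suc n} refl)))) (by-position (i ℕP.≤? suc k))
    where
    d≤n = ℕP.m∸n≤m n k
    n-d≡k : n ∸ d ≡ k
    n-d≡k = ℕP.m∸[m∸n]≡n k≤n
    X₁ₙ≡λₖ : X (1 , n) ≡ ℕ→ℚ (lam k k)
    X₁ₙ≡λₖ = trans (embGT-inside n k y (subst (d +ℕ 1 ≤_) d+k≡n (ℕP.+-monoʳ-≤ d 1≤k)))
                   (trans (cong (λ m → y (1 , m)) n-d≡k) (top-row k 1≤k ℕP.≤-refl))
    embF≡val : embF n k ψ (vert , i , suc n) ≡ val k ψ vert i (suc k)
    embF≡val = trans (embF-inside n k ψ {vert} {i} {suc n} (ℕP.m≤n⇒m≤1+n d≤n))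
                     (cong (val k ψ vert i) (trans (ℕP.+-∸-assoc 1 d≤n) (cong suc n-d≡k)))
    C = ℕ→ℚ (if (k +ℕ 2) ≤ᵇ i then lam k k else 0)
    by-position : Dec (i ≤ suc k) → (X (i′ , n) - X (1 , n)) + C ≡ embF n k ψ (vert , i , suc n)
    by-position (yes i≤1+k) = begin
      (X (i′ , n) - X (1 , n)) + C
        ≡⟨ cong₂ _+_ (cong₂ _-_ (embGT-inside n k y (subst (d +ℕ i′ ≤_) d+k≡n (ℕP.+-monoʳ-≤ d (s≤s⁻¹ i≤1+k))))
                                X₁ₙ≡λₖ)
                     (cong ℕ→ℚ (if-false (>⇒¬T≤ (subst (i <_) (ℕP.+-comm 2 k) (s≤s i≤1+k))))) ⟩
      (y (i′ , n ∸ d) - ℕ→ℚ (lam k k)) + 0ℚ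
        ≡⟨ trans (ℚP.+-identityʳ _) (cong₂ (λ m z → y (i′ , m) - z) n-d≡k (sym (top-row k 1≤k ℕP.≤-refl))) ⟩
      y (i′ , k) - y (1 , k)
        ≡⟨ sym (trans embF≡val (trans (val-edge ψ (right 3≤i i≤1+k)) (toFlow-right k y i))) ⟩
      embF n k ψ (vert , i , suc n) ∎
    by-position (no i≰1+k) = begin
      (X (i′ , n) - X (1 , n)) + C
        ≡⟨ cong₂ _+_ (cong₂ _-_ (embGT-outside n k y (subst (_< d +ℕ i′) d+k≡n (ℕP.+-monoʳ-< d (s≤s⁻¹ i>1+k))))
                                X₁ₙ≡λₖ)
                     (cong ℕ→ℚ (if-true (≤⇒T (subst (_≤ i) (ℕP.+-comm 2 k) i>1+k)))) ⟩
      (0ℚ - ℕ→ℚ (lam k k)) + ℕ→ℚ (lam k k)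
        ≡⟨ solve 1 (λ a → (con 0ℚ :- a) :+ a := con 0ℚ) refl (ℕ→ℚ (lam k k)) ⟩
      0ℚ
        ≡⟨ sym (trans embF≡val (val-nonEdge ψ (¬Edge-vert (λ _ _ 1+k≤k → ℕP.1+n≰n 1+k≤k)
                                                          (λ _ _ i≤1+k → i≰1+k i≤1+k)))) ⟩
      embF n k ψ (vert , i , suc n) ∎
      where
      i>1+k : suc k < i
      i>1+k = ℕP.≰⇒> i≰1+k

  toFlow-embGT-lower : ∀ {j} → 2 ≤ j → j ≤ n →
    toFlow n X (diag , suc j , j) + ℕ→ℚ (offset n lam k (diag , suc j , j)) ≡ embF n k ψ (diag , suc j , j)
  toFlow-embGT-lower {j} 2≤j j≤n =
    trans (cong₂ _+_ (toFlow-lower n X j) (cong ℕ→ℚ (if-true (≡⇒T {suc j} refl))))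
          (trans (ℚP.+-identityʳ _) (by-position (d ℕP.≟ 0)))
    where
    by-position : Dec (d ≡ 0) → X (1 , 1) - X (j , j) ≡ embF n k ψ (diag , suc j , j)
    by-position (yes d≡0) = begin
      X (1 , 1) - X (j , j)
        ≡⟨ cong₂ _-_ (embGT-inside n k y (subst (λ m → m +ℕ 1 ≤ 1) (sym d≡0) ℕP.≤-refl))
                     (embGT-inside n k y (subst (λ m → m +ℕ j ≤ j) (sym d≡0) ℕP.≤-refl)) ⟩
      y (1 , 1 ∸ d) - y (j , j ∸ d)
        ≡⟨ cong (λ m → y (1 , 1 ∸ m) - y (j , j ∸ m)) d≡0 ⟩
      y (1 , 1) - y (j , j)
        ≡⟨ sym (toFlow-lower k y j) ⟩
      ψ (diag , suc j , j)
        ≡⟨ sym (trans (embF-inside n k ψ {diag} {suc j} {j} (subst (_≤ j) (sym d≡0) z≤n))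
                      (trans (cong (λ m → val k ψ diag (suc j) (j ∸ m)) d≡0)
                             (val-edge ψ (lower 2≤j (subst (j ≤_) (trans (sym d+k≡n) (cong (_+ℕ k) d≡0)) j≤n))))) ⟩
      embF n k ψ (diag , suc j , j) ∎
    by-position (no d≢0) = begin
      X (1 , 1) - X (j , j)
        ≡⟨ cong₂ _-_ (embGT-outside n k y (subst (1 <_) (ℕP.+-comm 1 d) (s≤s 0<d)))
                     (embGT-outside n k y (subst (j <_) (ℕP.+-comm j d) (ℕP.m<m+n j 0<d))) ⟩
      0ℚ - 0ℚ
        ≡⟨ sym (embF-nonEdge n k ψ {diag} {suc j} {j} (λ d≤j → ¬Edge-diag
              (λ _ 1+j≤j-d _ → ℕP.<⇒≱ (s≤s (ℕP.m∸n≤m j d)) 1+j≤j-d)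
              (λ 1+j≡ _ _ → ℕP.<⇒≢ (ℕP.∸-monoʳ-< {j} {d} {0} 0<d d≤j) (ℕP.suc-injective (sym 1+j≡))))) ⟩
      embF n k ψ (diag , suc j , j) ∎
      where
      0<d : 0 < d
      0<d = ℕP.n≢0⇒n>0 d≢0

  toFlow-embGT : ∀ {t i j} → Edge n t i j →
    toFlow n X (t , i , j) + ℕ→ℚ (offset n lam k (t , i , j)) ≡ embF n k ψ (t , i , j)
  toFlow-embGT (inner vert 2≤i i≤j j≤n) = toFlow-embGT-vert 2≤i i≤j j≤n
  toFlow-embGT (inner diag 2≤i i≤j j≤n) = toFlow-embGT-diag 2≤i i≤j j≤n
  toFlow-embGT (right 3≤i _) = toFlow-embGT-right 3≤i
  toFlow-embGT (lower 2≤j j≤n) = toFlow-embGT-lower 2≤j j≤n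

-- The Minkowski sums

toFlow-cong : ∀ n {x x′ t i j} → (∀ s → s ∈ coords (GTSp n) → x s ≡ x′ s) → Edge n t i j →
              toFlow n x (t , i , j) ≡ toFlow n x′ (t , i , j)
toFlow-cong n x≈x′ e =
  cong₂ _-_ (x≈x′ _ (∈-GTSp⁺ n (proj₁ (pos-neg∈triangle e))))
            (x≈x′ _ (∈-GTSp⁺ n (proj₂ (pos-neg∈triangle e))))

module _ (n : ℕ) (lam : ℕ → ℕ → ℕ) where

  private
    S = GTSp n
    E = FSp n
    Ψ = gtFlowMap n lam
    ks = between 1 n
    open ≡-Reasoning

    k∈⇒1≤k : ∀ {k} → k ∈ ks → 1 ≤ k
    k∈⇒1≤k = proj₁ ∘ ∈-between⁻
    k∈⇒k≤n : ∀ {k} → k ∈ ks → k ≤ n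
    k∈⇒k≤n = proj₂ ∘ ∈-between⁻

    apply-Ψ : ∀ x {t i j} → (t , i , j) ∈ coords E →
              apply Ψ x (t , i , j) ≡ translation n lam (t , i , j) + toFlow n x (t , i , j)
    apply-Ψ x {t} {i} {j} e∈ = apply-gtFlowMap n lam x (validE⇒Edge {n} {t} {i} {j} (∈-FSp⁻ n e∈))

  embSum : (ℕ → ℕ × ℕ → ℚ) → ℕ × ℕ → ℚ
  embSum ys s = sumℚ (map (λ k → embGT n k (ys k) s) ks)

  gtFlowMap-embSum : ∀ ys → (∀ k → 1 ≤ k → k ≤ n → GT k (lam k) (ys k)) → ∀ {t i j} → Edge n t i j →
    translation n lam (t , i , j) + toFlow n (embSum ys) (t , i , j) ≡
    sumℚ (map (λ k → embF n k (toFlow k (ys k)) (t , i , j)) ks)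
  gtFlowMap-embSum ys gts {t} {i} {j} e = begin
    translation n lam ε + toFlow n (embSum ys) ε
      ≡⟨ ℚP.+-comm (translation n lam ε) _ ⟩
    toFlow n (embSum ys) ε + translation n lam ε
      ≡⟨ cong (_+ translation n lam ε) (sym (sumℚ-minus ks (λ k → X k (pos n ε)) (λ k → X k (neg n ε)))) ⟩
    sumℚ (map (λ k → toFlow n (X k) ε) ks) + translation n lam ε
      ≡⟨ sym (sumℚ-+ ks (λ k → toFlow n (X k) ε) (λ k → ℕ→ℚ (offset n lam k ε))) ⟩
    sumℚ (map (λ k → toFlow n (X k) ε + ℕ→ℚ (offset n lam k ε)) ks)
      ≡⟨ sumℚ-cong ks (λ k k∈ → toFlow-embGT lam (k∈⇒1≤k k∈) (k∈⇒k≤n k∈)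
                                             (gts k (k∈⇒1≤k k∈) (k∈⇒k≤n k∈)) e) ⟩
    sumℚ (map (λ k → embF n k (toFlow k (ys k)) ε) ks) ∎
    where
    ε = (t , i , j)
    X = λ k → embGT n k (ys k)

  embF-cong : ∀ k {F G} → (∀ {t i j} → Edge k t i j → F (t , i , j) ≡ G (t , i , j)) →
              ∀ e → embF n k F e ≡ embF n k G e
  embF-cong k F≈G (t , i , j) =
    if-cong-then ((n ∸ k) ≤ᵇ j) (λ _ → if-cong-then (validE k t i (j ∸ (n ∸ k))) (F≈G ∘ validE⇒Edge))

  gtFlowMap-into : ∀ x → GTSum n lam x → FSum n lam (apply Ψ x)
  gtFlowMap-into x (ys , gts , x≈) =
    (λ k → toFlow k (ys k)) , (λ k 1≤k k≤n → toFlow-flow {k} {lam k} {ys k} (gts k 1≤k k≤n)) ,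
    λ { (t , i , j) e∈ → let e = validE⇒Edge {n} {t} {i} {j} (∈-FSp⁻ n e∈) in
        trans (apply-Ψ x e∈) (trans (cong (_+_ (translation n lam (t , i , j))) (toFlow-cong n x≈ e))
                                    (gtFlowMap-embSum ys gts e)) }

  gtFlowMap-onto : ∀ z → FSum n lam z → ∃ λ x → GTSum n lam x × (∀ e → e ∈ coords E → apply Ψ x e ≡ z e)
  gtFlowMap-onto z (fs , flows , z≈) = embSum ys , (ys , gts , λ _ _ → refl) ,
    λ { (t , i , j) e∈ → let e = validE⇒Edge {n} {t} {i} {j} (∈-FSp⁻ n e∈) in begin
      apply Ψ (embSum ys) (t , i , j)
        ≡⟨ apply-Ψ (embSum ys) e∈ ⟩
      translation n lam (t , i , j) + toFlow n (embSum ys) (t , i , j)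
        ≡⟨ gtFlowMap-embSum ys gts e ⟩
      sumℚ (map (λ k → embF n k (toFlow k (ys k)) (t , i , j)) ks)
        ≡⟨ sumℚ-cong ks (λ k k∈ → embF-cong k (toFlow-toGT {k} {lam k} {fs k} (flows k (k∈⇒1≤k k∈) (k∈⇒k≤n k∈)))
                                             (t , i , j)) ⟩
      sumℚ (map (λ k → embF n k (fs k) (t , i , j)) ks)
        ≡⟨ sym (z≈ _ e∈) ⟩
      z (t , i , j) ∎ }
    where
    ys : ℕ → ℕ × ℕ → ℚ
    ys k = toGT (lam k) (fs k)
    gts : ∀ k → 1 ≤ k → k ≤ n → GT k (lam k) (ys k)
    gts k 1≤k k≤n = toGT-GT {k} {lam k} {fs k} (flows k 1≤k k≤n)

  topRow : ℕ → ℚ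
  topRow j = embSum (λ k s → ℕ→ℚ (lam k (proj₂ s))) (1 , j)

  GTSum-topRow : ∀ {x} → GTSum n lam x → ∀ {j} → 1 ≤ j → j ≤ n → x (1 , j) ≡ topRow j
  GTSum-topRow (ys , gts , x≈) {j} 1≤j j≤n =
    trans (x≈ (1 , j) (∈-GTSp⁺ n (ℕP.≤-refl , 1≤j , j≤n))) (sumℚ-cong ks summand)
    where
    summand : ∀ k → k ∈ ks → embGT n k (ys k) (1 , j) ≡ embGT n k (λ s → ℕ→ℚ (lam k (proj₂ s))) (1 , j)
    summand k k∈ = if-cong-then (((n ∸ k) +ℕ 1) ≤ᵇ j) λ inside →
      proj₁ (proj₂ (gts k (k∈⇒1≤k k∈) (k∈⇒k≤n k∈))) (j ∸ (n ∸ k))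
        (m+n≤o⇒n≤o∸m (n ∸ k) (T⇒≤ inside))
        (ℕP.m≤n+o⇒m∸n≤o j (n ∸ k) (subst (j ≤_) (sym (ℕP.m∸n+n≡m (k∈⇒k≤n k∈))) j≤n))

  Aff-topRow : ∀ {x} → Aff S (GTSum n lam) x → ∀ {j} → 1 ≤ j → j ≤ n → x (1 , j) ≡ topRow j
  Aff-topRow {x} (l , l⊆P , Σc≡1 , x≈) {j} 1≤j j≤n = begin
    x (1 , j)
      ≡⟨ x≈ (1 , j) (∈-GTSp⁺ n (ℕP.≤-refl , 1≤j , j≤n)) ⟩
    combination l (1 , j)
      ≡⟨ sumℚ-cong l (λ a a∈ → cong (proj₁ a *_) (GTSum-topRow (l⊆P (proj₁ a) (proj₂ a) a∈) 1≤j j≤n)) ⟩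
    sumℚ (map (λ a → proj₁ a * topRow j) l)
      ≡⟨ sumℚ-*ʳ l (topRow j) proj₁ ⟩
    sumℚ (map proj₁ l) * topRow j
      ≡⟨ trans (cong (_* topRow j) Σc≡1) (ℚP.*-identityˡ (topRow j)) ⟩
    topRow j ∎

  apply-diag : ∀ x {i j} → 2 ≤ i → i ≤ j → j ≤ n →
    x (i , j) ≡ (apply Ψ x (diag , i , j) - translation n lam (diag , i , j)) + x (i ∸ 1 , j)
  apply-diag x {i} {j} 2≤i i≤j j≤n = sym (begin
    (apply Ψ x (diag , i , j) - b) + x (i ∸ 1 , j)
      ≡⟨ cong (λ z → (z - b) + x (i ∸ 1 , j)) (apply-gtFlowMap n lam x (inner diag 2≤i i≤j j≤n)) ⟩
    ((b + toFlow n x (diag , i , j)) - b) + x (i ∸ 1 , j)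
      ≡⟨ cong (λ z → ((b + z) - b) + x (i ∸ 1 , j)) (toFlow-diag n x i≤j) ⟩
    ((b + (x (i , j) - x (i ∸ 1 , j))) - b) + x (i ∸ 1 , j)
      ≡⟨ solve 3 (λ b u v → ((b :+ (u :- v)) :- b) :+ v := u) refl b (x (i , j)) (x (i ∸ 1 , j)) ⟩
    x (i , j) ∎)
    where b = translation n lam (diag , i , j)

  ≈-by-topRow : ∀ x x′ → (∀ {j} → 1 ≤ j → j ≤ n → x (1 , j) ≡ x′ (1 , j)) →
    (∀ e → e ∈ coords E → apply Ψ x e ≡ apply Ψ x′ e) → ∀ s → s ∈ coords S → x s ≡ x′ s
  ≈-by-topRow x x′ top≡ image≡ s s∈ = go s (∈-GTSp⁻ n s∈)
    where
    go : ∀ s → InTriangle n s → x s ≡ x′ s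
    go (suc zero , j) (_ , 1≤j , j≤n) = top≡ 1≤j j≤n
    go (suc (suc i) , j) (_ , i≤j , j≤n) =
      trans (apply-diag x 2≤i i≤j j≤n)
        (trans (cong₂ (λ a c → (a - translation n lam (diag , suc (suc i) , j)) + c)
                      (image≡ _ (∈-FSp⁺ n (inner diag 2≤i i≤j j≤n)))
                      (go (suc i , j) (s≤s z≤n , ℕP.≤-trans (ℕP.n≤1+n _) i≤j , j≤n)))
               (sym (apply-diag x′ 2≤i i≤j j≤n)))
      where 2≤i = s≤s (s≤s z≤n)

  IsInt-translation : ∀ e → IsInt (translation n lam e)
  IsInt-translation e = IsInt-sumℚ ks _ (λ k _ → IsInt-ℕ→ℚ (offset n lam k e))

  IsIntPt-by-topRow : ∀ x → (∀ {j} → 1 ≤ j → j ≤ n → IsInt (x (1 , j))) →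
    (∀ e → e ∈ coords E → IsInt (apply Ψ x e)) → IsIntPt S x
  IsIntPt-by-topRow x top∈ℤ image∈ℤ s s∈ = go s (∈-GTSp⁻ n s∈)
    where
    go : ∀ s → InTriangle n s → IsInt (x s)
    go (suc zero , j) (_ , 1≤j , j≤n) = top∈ℤ 1≤j j≤n
    go (suc (suc i) , j) (_ , i≤j , j≤n) =
      subst IsInt (sym (apply-diag x 2≤i i≤j j≤n))
        (IsInt-+ {apply Ψ x e - translation n lam e} {x (suc i , j)}
          (IsInt-minus {apply Ψ x e} {translation n lam e} (image∈ℤ e (∈-FSp⁺ n (inner diag 2≤i i≤j j≤n)))
                                                           (IsInt-translation e))
          (go (suc i , j) (s≤s z≤n , ℕP.≤-trans (ℕP.n≤1+n _) i≤j , j≤n)))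
      where
      2≤i = s≤s (s≤s z≤n)
      e = (diag , suc (suc i) , j)

  IsInt-topRow : ∀ j → IsInt (topRow j)
  IsInt-topRow j = IsInt-sumℚ ks _ (λ k _ → IsInt-embGT k)
    where
    IsInt-embGT : ∀ k → IsInt (embGT n k (λ s → ℕ→ℚ (lam k (proj₂ s))) (1 , j))
    IsInt-embGT k with ((n ∸ k) +ℕ 1) ≤ᵇ j
    ... | true = IsInt-ℕ→ℚ (lam k (j ∸ (n ∸ k)))
    ... | false = refl

  IsIntPt-image : ∀ x → IsIntPt S x → IsIntPt E (apply Ψ x)
  IsIntPt-image x x∈ℤ (t , i , j) e∈ = subst IsInt (sym (apply-Ψ x e∈))
    (IsInt-+ {translation n lam ε} {x (pos n ε) - x (neg n ε)} (IsInt-translation ε)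
      (IsInt-minus {x (pos n ε)} {x (neg n ε)} (x∈ℤ _ (∈-GTSp⁺ n (proj₁ (pos-neg∈triangle e))))
                                                (x∈ℤ _ (∈-GTSp⁺ n (proj₂ (pos-neg∈triangle e))))))
    where
    ε = (t , i , j)
    e = validE⇒Edge {n} {t} {i} {j} (∈-FSp⁻ n e∈)

  gtFlowMap-bijective : BijOn S E Ψ (GTSum n lam) (FSum n lam)
  gtFlowMap-bijective =
      gtFlowMap-into
    , (λ x x′ Px Px′ → ≈-by-topRow x x′
         (λ 1≤j j≤n → trans (GTSum-topRow Px 1≤j j≤n) (sym (GTSum-topRow Px′ 1≤j j≤n))))
    , gtFlowMap-onto

  gtFlowMap-bijectiveℤ : BijOn S E Ψ (IntAff S (GTSum n lam)) (IntAff E (FSum n lam))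
  gtFlowMap-bijectiveℤ =
      (λ x (Aff-x , x∈ℤ) → Aff-image Ψ gtFlowMap-into x Aff-x , IsIntPt-image x x∈ℤ)
    , (λ x x′ (Aff-x , _) (Aff-x′ , _) → ≈-by-topRow x x′
         (λ 1≤j j≤n → trans (Aff-topRow Aff-x 1≤j j≤n) (sym (Aff-topRow Aff-x′ 1≤j j≤n))))
    , onto
    where
    onto : ∀ z → IntAff E (FSum n lam) z →
           ∃ λ x → IntAff S (GTSum n lam) x × (∀ e → e ∈ coords E → apply Ψ x e ≡ z e)
    onto z (Aff-z , z∈ℤ) with Aff-preimage Ψ gtFlowMap-onto z Aff-z
    ... | x , Aff-x , Ψx≈z = x , (Aff-x , x∈ℤ) , Ψx≈z
      where
      x∈ℤ : IsIntPt S x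
      x∈ℤ = IsIntPt-by-topRow x (λ {j} 1≤j j≤n → subst IsInt (sym (Aff-topRow Aff-x 1≤j j≤n)) (IsInt-topRow j))
                                (λ e e∈ → subst IsInt (sym (Ψx≈z e e∈)) (z∈ℤ e e∈))

lemma3p11 : (n : ℕ) → 2 ≤ n → (lam : ℕ → ℕ → ℕ) →
    (∀ k → 1 ≤ k → k ≤ n → IsPartition k (lam k)) →
    IntEquiv (GTSp n) (FSp n) (GTSum n lam) (FSum n lam)
lemma3p11 n _ lam _ = gtFlowMap n lam , gtFlowMap-bijective n lam , gtFlowMap-bijectiveℤ n lam
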